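{- For a partition $\lambda$ of $n$ and a composition $\beta$ of $n$, $$R_{\lambda\beta}\frac{n!}{z_\lambda}=\sum_{\substack{\alpha\preccurlyeq\beta\\ \widetilde{\alpha}=\lambda}}\frac{n!}{\pi(\alpha,\beta)}.$$
   Context: A composition of $n$ is a sequence of positive integers summing to $n$; $\ell(\alpha)$ is its number of parts; $\widetilde{\alpha}$ is the partition obtained by sorting its parts decreasingly. $\alpha\preccurlyeq\beta$ means $\beta$ is obtained from $\alpha$ by summing consecutive blocks of parts; $\alpha^{(i)}$ is the block of parts of $\alpha$ summing to $\beta_i$. $\pi(\gamma)=\prod_{i=1}^{\ell(\gamma)}(\gamma_1+\cdots+\gamma_i)$, $\pi(\alpha,\beta)=\prod_{i=1}^{\ell(\beta)}\pi(\alpha^{(i)})$. $z_\lambda=\prod_i i^{m_i}m_i!$ with $m_i$ the number of parts of $\lambda$ equal to $i$. $R_{\lambda\beta}$ is the number of ordered set partitions $(B_1,\dots,B_{\ell(\beta)})$ of $\{1,\dots,\ell(\lambda)\}$ with $\beta_j=\sum_{i\in B_j}\lambda_i$ for $1\le j\le\ell(\beta)$. -}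

module Defs where

open import Data.Nat using (ℕ; zero; suc; _+_; _*_; _^_; _<_)
open import Data.Nat.Properties using (≤-decTotalOrder)
open import Relation.Binary.Construct.Flip.EqAndOrd using (decTotalOrder)
open import Data.Nat using (_!)
open import Data.Fin using (Fin)
open import Data.Vec using (Vec; []; _∷_; lookup)
open import Data.List using (List; []; _∷_; _++_; map; concat; concatMap; length; upTo; filter; foldr)
open import Data.Nat.ListAction using (sum; product)
open import Data.List.Relation.Unary.All using (All)
open import Data.List.Relation.Unary.Linked using (Linked)
open import Data.List.Properties using (≡-dec)
open import Data.Fin using (_≟_)
open import Data.Integer using (+_)
open import Data.Rational using (ℚ; 0ℚ; _/_) renaming (_+_ to _+ℚ_)
open import Data.Product using (_×_)
open import Relation.Binary.PropositionalEquality using (_≡_)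
open import Relation.Nullary using (Dec; yes; no)
open import Data.Bool using (Bool)
import Data.List
import Data.Bool.ListAction
import Data.Nat as ℕ
import Data.List.Sort.InsertionSort as IS

IsComposition : ℕ → List ℕ → Set
IsComposition n α = All (0 <_) α × sum α ≡ n

IsPartition : ℕ → List ℕ → Set
IsPartition n λ' = IsComposition n λ' × Linked ℕ._≥_ λ'

sortDesc : List ℕ → List ℕ
sortDesc = IS.sort (decTotalOrder ≤-decTotalOrder)

incHead : List ℕ → List ℕ
incHead []       = []
incHead (x ∷ xs) = suc x ∷ xs

-- every composition of m+2 either starts with part 1 followed by a
-- composition of m+1, or is a composition of m+1 with first part increased
compositions : ℕ → List (List ℕ)
compositions zero          = [] ∷ []
compositions (suc zero)    = (1 ∷ []) ∷ []
compositions (suc (suc m)) =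
  map (1 ∷_) (compositions (suc m)) ++ map incHead (compositions (suc m))

-- All refinements α ≼ β, each given by its block decomposition
-- (α^(1), …, α^(ℓ(β))) with α^(i) a composition of β_i; α = concat of blocks.
refinements : List ℕ → List (List (List ℕ))
refinements []       = [] ∷ []
refinements (b ∷ bs) =
  concatMap (λ c → map (c ∷_) (refinements bs)) (compositions b)

-- π(γ) = ∏_i (γ_1 + ⋯ + γ_i)
πacc : ℕ → List ℕ → ℕ
πacc acc []       = 1
πacc acc (x ∷ xs) = (acc + x) * πacc (acc + x) xs

πc : List ℕ → ℕ
πc = πacc 0

-- π(α,β) = ∏_i π(α^(i)), given the block decomposition of α w.r.t. β
πblocks : List (List ℕ) → ℕ
πblocks blocks = product (map πc blocks)

mult : ℕ → List ℕ → ℕ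
mult i λ' = length (filter (i ℕ.≟_) λ')

-- z_λ = ∏_{i ≥ 1} i^{m_i} m_i!  (parts of a partition of n are ≤ n = sum λ)
zee : List ℕ → ℕ
zee λ' = product (map (λ i → (i ^ mult i λ') * (mult i λ') !) (map suc (upTo (sum λ'))))

-- R_{λβ}: ordered set partitions (B_1,…,B_ℓ(β)) of {1,…,ℓ(λ)} with
-- β_j = ∑_{i∈B_j} λ_i, encoded as the block-assignment map
-- f : Fin ℓ(λ) → Fin ℓ(β) (B_j = f⁻¹(j)), given as a vector.

allVecs : {k : ℕ} → List (Fin k) → (a : ℕ) → List (Vec (Fin k) a)
allVecs xs zero    = [] ∷ []
allVecs xs (suc a) = concatMap (λ x → map (x ∷_) (allVecs xs a)) xs

blockSum : {k a : ℕ} → Vec (Fin k) a → List ℕ → Fin k → ℕ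
blockSum []      _        j = 0
blockSum (_ ∷ _) []       j = 0
blockSum (x ∷ f) (l ∷ ls) j with x ≟ j
... | yes _ = l + blockSum f ls j
... | no  _ = blockSum f ls j

admissible : (λ' β : List ℕ) → Vec (Fin (length β)) (length λ') → Bool
admissible λ' β f =
  Data.Bool.ListAction.all (λ j → blockSum f λ' j ℕ.≡ᵇ Data.List.lookup β j) (Data.List.allFin (length β))

R : List ℕ → List ℕ → ℕ
R λ' β = length (Data.List.filterᵇ (admissible λ' β)
                   (allVecs (Data.List.allFin (length β)) (length λ')))

-- a / b as a rational number (b ≠ 0 in every use below; junk value 0 for b = 0)
ratio : ℕ → ℕ → ℚ
ratio a zero    = 0ℚ
ratio a (suc b) = (+ a) / suc b

sumℚ : List ℚ → ℚ
sumℚ = foldr _+ℚ_ 0ℚ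

rhs : ℕ → List ℕ → List ℕ → ℚ
rhs n λ' β = sumℚ (map (λ bs → ratio (n !) (πblocks bs))
                     (filter (λ bs → ≡-dec ℕ._≟_ (sortDesc (concat bs)) λ') (refinements β)))

module Submission where

-- Write S(λ,β) = ∑_{α ≼ β, α̃ = λ} 1/π(α,β).  After dividing by n! the claim is the
-- identity  z_λ · S(λ,β) = R_{λβ},  proved by induction on ℓ(λ) and on β, showing that both
-- sides obey the same recursion in the first part B = β₁:
--   * parts β₁ = 0 can be dropped on both sides;
--   * B · S(λ,β) = ∑_{x} [x ∈ λ] S(λ∖x, (B-x, β₂, …)): remove the last part x of the first
--     block α^(1) = c ++ [x]; the last partial sum of α^(1) is B, so π loses the factor B;
--   * B · R_{λβ} = ∑_{i} [λ_i ≤ B] λ_i R_{λ∖λ_i, (B-λ_i, β₂, …)}: double counting the pairs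
--     (ordered set partition, index i in its first block);
--   * z_λ = x · m_x(λ) · z_{λ∖x}  converts the sum over values x into the sum over indices i.

open import Data.Bool using (Bool; true; false; T; T?; _∧_; if_then_else_)
open import Data.Bool.ListAction using (all)
import Data.Bool.Properties
open import Data.Fin as Fin using (Fin)
open import Data.Integer as ℤ using ()
import Data.Integer.Properties as ℤ
open import Data.List using (List; []; _∷_; _++_; _∷ʳ_; map; concat; concatMap; length; filter; filterᵇ; upTo; allFin; lookup)
open import Data.List.Membership.Propositional using (_∈_)
open import Data.List.Membership.Propositional.Properties using (∈-insert; ∈-map⁺; ∈-upTo⁺)
open import Data.List.Properties using (≡-dec; ++-assoc; map-upTo; map-tabulate; filter-accept; filter-reject; filter-none)
open import Data.List.Relation.Binary.Permutation.Propositional using (_↭_; ↭⇒↭ₛ′; ↭-sym; ↭-trans; ↭-refl; prep; swap)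
open import Data.List.Relation.Binary.Permutation.Propositional.Properties using (shift; drop-∷; ∈-resp-↭)
open import Data.List.Relation.Binary.Pointwise using (Pointwise-≡⇒≡)
open import Data.List.Relation.Unary.All as All using (All; []; _∷_)
import Data.List.Relation.Unary.All.Properties as All
open import Data.List.Relation.Unary.Any using (here; there)
open import Data.List.Relation.Unary.Linked using (Linked; []; [-]; _∷_)
open import Data.List.Relation.Unary.Sorted.TotalOrder.Properties using (↗↭↗⇒≋)
open import Data.List.Relation.Unary.Unique.Propositional using (Unique; _∷_)
import Data.List.Relation.Unary.Unique.Propositional.Properties as Unique
import Data.List.Sort.InsertionSort.Properties
open import Data.Nat as ℕ using (ℕ; zero; suc; _∸_; _≤_; _<_; _≤ᵇ_; _≡ᵇ_; _^_; _!; s≤s; z≤n)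
open import Data.Nat.ListAction using (sum; product)
open import Data.Nat.ListAction.Properties using (product≢0)
import Data.Nat.Properties as ℕ
import Data.Nat.Solver as ℕSolver
open import Data.List.Membership.DecPropositional ℕ._≟_ using (_∈?_)
open import Data.Product as Product using (_×_; _,_; proj₁; proj₂)
open import Data.Rational as ℚ using (ℚ; 0ℚ; 1ℚ; _+_; _*_; _/_)
import Data.Rational.Properties as ℚ
open import Data.Rational.Solver using (module +-*-Solver)
import Data.Rational.Unnormalised as ℚᵘ
import Data.Rational.Unnormalised.Properties as ℚᵘ
open import Data.Sum using (inj₁; inj₂)
open import Data.Vec as Vec using (Vec; _∷_)
open import Function using (_∘_; module Equivalence)
open import Relation.Binary.Bundles using (DecTotalOrder)
open import Relation.Binary.Construct.Flip.EqAndOrd using (decTotalOrder)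
open import Relation.Binary.PropositionalEquality
open import Relation.Nullary using (Dec; yes; no; does; ¬_; _×-dec_)
open import Relation.Nullary.Negation using (contradiction)

open import Defs

open +-*-Solver using (solve; _:+_; _:*_; _:=_; con)
open ℕSolver.+-*-Solver using () renaming (solve to ℕsolve; _:+_ to _ℕ:+_; _:*_ to _ℕ:*_; _:=_ to _ℕ:=_; con to ℕcon)
open ≡-Reasoning

⟦_⟧ : ℕ → ℚ
⟦ n ⟧ = (ℤ.+ n) / 1

-- 1/n, with the junk value 1/0 = 0 inherited from ratio.
inv : ℕ → ℚ
inv n = ratio 1 n

fromℚᵘ-homo-* : ∀ x y → ℚ.fromℚᵘ (x ℚᵘ.* y) ≡ ℚ.fromℚᵘ x * ℚ.fromℚᵘ y
fromℚᵘ-homo-* x y = ℚ.toℚᵘ-injective (ℚᵘ.≃-trans (ℚ.toℚᵘ-fromℚᵘ (x ℚᵘ.* y))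
  (ℚᵘ.≃-trans (ℚᵘ.*-cong (ℚᵘ.≃-sym (ℚ.toℚᵘ-fromℚᵘ x)) (ℚᵘ.≃-sym (ℚ.toℚᵘ-fromℚᵘ y)))
    (ℚᵘ.≃-sym (ℚ.toℚᵘ-homo-* (ℚ.fromℚᵘ x) (ℚ.fromℚᵘ y)))))

fromℚᵘ-homo-+ : ∀ x y → ℚ.fromℚᵘ (x ℚᵘ.+ y) ≡ ℚ.fromℚᵘ x + ℚ.fromℚᵘ y
fromℚᵘ-homo-+ x y = ℚ.toℚᵘ-injective (ℚᵘ.≃-trans (ℚ.toℚᵘ-fromℚᵘ (x ℚᵘ.+ y))
  (ℚᵘ.≃-trans (ℚᵘ.+-cong (ℚᵘ.≃-sym (ℚ.toℚᵘ-fromℚᵘ x)) (ℚᵘ.≃-sym (ℚ.toℚᵘ-fromℚᵘ y)))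
    (ℚᵘ.≃-sym (ℚ.toℚᵘ-homo-+ (ℚ.fromℚᵘ x) (ℚ.fromℚᵘ y)))))

-- The integer  m/(1+d)  as an unnormalised rational.
frac : ℕ → ℕ → ℚᵘ.ℚᵘ
frac m d = ℚᵘ.mkℚᵘ (ℤ.+ m) d

⟦⟧-homo-+ : ∀ m n → ⟦ m ℕ.+ n ⟧ ≡ ⟦ m ⟧ + ⟦ n ⟧
⟦⟧-homo-+ m n = trans (ℚ.fromℚᵘ-cong (ℚᵘ.≃-reflexive (cong (λ z → ℚᵘ.mkℚᵘ z 0) same-numerator)))
                      (fromℚᵘ-homo-+ (frac m 0) (frac n 0))
  where
  same-numerator : ℤ.+ (m ℕ.+ n) ≡ (ℤ.+ m) ℤ.* (ℤ.+ 1) ℤ.+ (ℤ.+ n) ℤ.* (ℤ.+ 1)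
  same-numerator = trans (ℤ.pos-+ m n) (sym (cong₂ ℤ._+_ (ℤ.*-identityʳ (ℤ.+ m)) (ℤ.*-identityʳ (ℤ.+ n))))

⟦⟧-homo-* : ∀ m n → ⟦ m ℕ.* n ⟧ ≡ ⟦ m ⟧ * ⟦ n ⟧
⟦⟧-homo-* m n = trans (ℚ.fromℚᵘ-cong (ℚᵘ.≃-reflexive (cong (λ z → ℚᵘ.mkℚᵘ z 0) (ℤ.pos-* m n))))
                      (fromℚᵘ-homo-* (frac m 0) (frac n 0))

ratio≡⟦⟧*inv : ∀ a b → ratio a b ≡ ⟦ a ⟧ * inv b
ratio≡⟦⟧*inv a zero    = sym (ℚ.*-zeroʳ ⟦ a ⟧)
ratio≡⟦⟧*inv a (suc b) =
  trans (ℚ.fromℚᵘ-cong (ℚᵘ.≃-reflexive (cong₂ ℚᵘ.mkℚᵘ (sym (ℤ.*-identityʳ (ℤ.+ a)))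
                                                       (sym (ℕ.+-identityʳ b)))))
        (fromℚᵘ-homo-* (frac a 0) (frac 1 b))

inv-homo-* : ∀ a b → inv (a ℕ.* b) ≡ inv a * inv b
inv-homo-* zero    b       = sym (ℚ.*-zeroˡ (inv b))
inv-homo-* (suc a) zero    = trans (cong inv (ℕ.*-zeroʳ a)) (sym (ℚ.*-zeroʳ (inv (suc a))))
inv-homo-* (suc a) (suc b) = fromℚᵘ-homo-* (frac 1 a) (frac 1 b)

⟦⟧*inv : ∀ n .{{_ : ℕ.NonZero n}} → ⟦ n ⟧ * inv n ≡ 1ℚ
⟦⟧*inv (suc n) =
  trans (sym (fromℚᵘ-homo-* (frac (suc n) 0) (frac 1 n)))
        (ℚ.fromℚᵘ-cong {frac (suc n) 0 ℚᵘ.* frac 1 n} {frac 1 0}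
          (ℚᵘ.*≡* (trans (ℤ.*-identityʳ _) (trans (ℤ.*-identityʳ (ℤ.+ suc n))
            (cong (ℤ.+_ ∘ suc) (sym (trans (ℕ.+-identityʳ _) (ℕ.+-identityʳ n))))))))

⟦⟧-cancelˡ : ∀ b {x y} → ⟦ suc b ⟧ * x ≡ ⟦ suc b ⟧ * y → x ≡ y
⟦⟧-cancelˡ b {x} {y} e = trans (unscale x) (trans (cong (inv (suc b) *_) e) (sym (unscale y)))
  where
  unscale : ∀ z → z ≡ inv (suc b) * (⟦ suc b ⟧ * z)
  unscale z = begin
    z                                   ≡⟨ sym (ℚ.*-identityˡ z) ⟩
    1ℚ * z                              ≡⟨ cong (_* z) (sym (trans (ℚ.*-comm (inv (suc b)) ⟦ suc b ⟧)
                                                                    (⟦⟧*inv (suc b)))) ⟩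
    (inv (suc b) * ⟦ suc b ⟧) * z       ≡⟨ ℚ.*-assoc (inv (suc b)) ⟦ suc b ⟧ z ⟩
    inv (suc b) * (⟦ suc b ⟧ * z)       ∎

𝟙ᵇ : Bool → ℚ
𝟙ᵇ true  = 1ℚ
𝟙ᵇ false = 0ℚ

𝟙 : {P : Set} → Dec P → ℚ
𝟙 d = 𝟙ᵇ (does d)

𝟙-no : {P : Set} (d : Dec P) → ¬ P → 𝟙 d ≡ 0ℚ
𝟙-no (yes p) ¬p = contradiction p ¬p
𝟙-no (no _)  _  = refl

𝟙-⇔ : {P Q : Set} (p : Dec P) (q : Dec Q) → (P → Q) → (Q → P) → 𝟙 p ≡ 𝟙 q
𝟙-⇔ (yes _) (yes _) _ _ = refl
𝟙-⇔ (yes p) (no ¬q) f _ = contradiction (f p) ¬q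
𝟙-⇔ (no ¬p) (yes q) _ g = contradiction (g q) ¬p
𝟙-⇔ (no _)  (no _)  _ _ = refl

𝟙-*-cong : {P : Set} (d : Dec P) {a b : ℚ} → (P → a ≡ b) → 𝟙 d * a ≡ 𝟙 d * b
𝟙-*-cong (yes p) a≡b = cong (1ℚ *_) (a≡b p)
𝟙-*-cong (no _)  {a} {b} _ = trans (ℚ.*-zeroˡ a) (sym (ℚ.*-zeroˡ b))

𝟙ᵇ-∧ : ∀ a b → 𝟙ᵇ (a ∧ b) ≡ 𝟙ᵇ a * 𝟙ᵇ b
𝟙ᵇ-∧ false b = sym (ℚ.*-zeroˡ (𝟙ᵇ b))
𝟙ᵇ-∧ true  b = sym (ℚ.*-identityˡ (𝟙ᵇ b))

𝟙-× : {P Q : Set} (p : Dec P) (q : Dec Q) → 𝟙 (p ×-dec q) ≡ 𝟙 p * 𝟙 q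
𝟙-× p q = 𝟙ᵇ-∧ (does p) (does q)

private variable
  A A′ : Set

∑ : List A → (A → ℚ) → ℚ
∑ xs f = sumℚ (map f xs)

syntax ∑ xs (λ x → e) = ∑[ x ∈ xs ] e

∑-++ : ∀ xs ys (f : A → ℚ) → ∑ (xs ++ ys) f ≡ ∑ xs f + ∑ ys f
∑-++ []       ys f = sym (ℚ.+-identityˡ _)
∑-++ (x ∷ xs) ys f = trans (cong (f x +_) (∑-++ xs ys f)) (sym (ℚ.+-assoc (f x) _ _))

∑-map : ∀ (g : A → A′) xs (f : A′ → ℚ) → ∑ (map g xs) f ≡ ∑ xs (f ∘ g)
∑-map g []       f = refl
∑-map g (x ∷ xs) f = cong (f (g x) +_) (∑-map g xs f)

∑-concatMap : ∀ (g : A → List A′) xs (f : A′ → ℚ) → ∑ (concatMap g xs) f ≡ ∑[ x ∈ xs ] ∑ (g x) f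
∑-concatMap g []       f = refl
∑-concatMap g (x ∷ xs) f =
  trans (∑-++ (g x) (concatMap g xs) f) (cong (∑ (g x) f +_) (∑-concatMap g xs f))

∑-cong : ∀ xs {f g : A → ℚ} → (∀ x → f x ≡ g x) → ∑ xs f ≡ ∑ xs g
∑-cong []       e = refl
∑-cong (x ∷ xs) e = cong₂ _+_ (e x) (∑-cong xs e)

∑-congᴬ : ∀ {P : A → Set} {xs} {f g : A → ℚ} → All P xs → (∀ x → P x → f x ≡ g x) → ∑ xs f ≡ ∑ xs g
∑-congᴬ []         e = refl
∑-congᴬ (px ∷ pxs) e = cong₂ _+_ (e _ px) (∑-congᴬ pxs e)

∑-+ : ∀ xs (f g : A → ℚ) → ∑[ x ∈ xs ] (f x + g x) ≡ ∑ xs f + ∑ xs g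
∑-+ []       f g = refl
∑-+ (x ∷ xs) f g = trans (cong ((f x + g x) +_) (∑-+ xs f g))
  (solve 4 (λ a b c d → (a :+ b) :+ (c :+ d) := (a :+ c) :+ (b :+ d)) refl (f x) (g x) (∑ xs f) (∑ xs g))

∑-*ˡ : ∀ xs c (f : A → ℚ) → c * ∑ xs f ≡ ∑[ x ∈ xs ] (c * f x)
∑-*ˡ []       c f = ℚ.*-zeroʳ c
∑-*ˡ (x ∷ xs) c f = trans (ℚ.*-distribˡ-+ c (f x) _) (cong (c * f x +_) (∑-*ˡ xs c f))

∑-zero : ∀ (xs : List A) → ∑[ x ∈ xs ] 0ℚ ≡ 0ℚ
∑-zero []       = refl
∑-zero (x ∷ xs) = trans (ℚ.+-identityˡ _) (∑-zero xs)

∑-swap : ∀ (xs : List A) (ys : List A′) (f : A → A′ → ℚ) →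
         ∑[ x ∈ xs ] ∑ ys (f x) ≡ ∑[ y ∈ ys ] ∑[ x ∈ xs ] f x y
∑-swap []       ys f = sym (∑-zero ys)
∑-swap (x ∷ xs) ys f =
  trans (cong (∑ ys (f x) +_) (∑-swap xs ys f)) (sym (∑-+ ys (f x) (λ y → ∑[ x′ ∈ xs ] f x′ y)))

∑-filter : ∀ {P : A → Set} (P? : ∀ x → Dec (P x)) xs (f : A → ℚ) →
           ∑ (filter P? xs) f ≡ ∑[ x ∈ xs ] (𝟙 (P? x) * f x)
∑-filter P? []       f = refl
∑-filter P? (x ∷ xs) f with does (P? x)
... | true  = cong₂ _+_ (sym (ℚ.*-identityˡ (f x))) (∑-filter P? xs f)
... | false = trans (∑-filter P? xs f)
                    (trans (sym (ℚ.+-identityˡ _)) (cong (_+ _) (sym (ℚ.*-zeroˡ (f x)))))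

length-filterᵇ : ∀ (p : A → Bool) xs → ⟦ length (filterᵇ p xs) ⟧ ≡ ∑[ x ∈ xs ] 𝟙ᵇ (p x)
length-filterᵇ p []       = refl
length-filterᵇ p (x ∷ xs) with p x
... | true  = trans (⟦⟧-homo-+ 1 (length (filterᵇ p xs))) (cong (1ℚ +_) (length-filterᵇ p xs))
... | false = trans (length-filterᵇ p xs) (sym (ℚ.+-identityˡ _))

∑-upTo-suc : ∀ n (F : ℕ → ℚ) → ∑ (upTo (suc n)) F ≡ F 0 + ∑[ k ∈ upTo n ] F (suc k)
∑-upTo-suc n F = cong (F 0 +_) (trans (cong (λ ks → ∑ ks F) (sym (map-upTo suc n)))
                                       (∑-map suc (upTo n) F))

∑-upTo-cong : ∀ n {f g : ℕ → ℚ} → (∀ k → k < n → f k ≡ g k) → ∑ (upTo n) f ≡ ∑ (upTo n) g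
∑-upTo-cong zero    e = refl
∑-upTo-cong (suc n) {f} {g} e = begin
  ∑ (upTo (suc n)) f                 ≡⟨ ∑-upTo-suc n f ⟩
  f 0 + ∑[ k ∈ upTo n ] f (suc k)    ≡⟨ cong₂ _+_ (e 0 (s≤s z≤n))
                                                  (∑-upTo-cong n (λ k k<n → e (suc k) (s≤s k<n))) ⟩
  g 0 + ∑[ k ∈ upTo n ] g (suc k)    ≡⟨ sym (∑-upTo-suc n g) ⟩
  ∑ (upTo (suc n)) g                 ∎

compositions-sum : ∀ k → All (λ c → sum c ≡ k) (compositions k)
compositions-sum zero          = refl ∷ []
compositions-sum (suc zero)    = refl ∷ []
compositions-sum (suc (suc m)) = All.++⁺ (All.map⁺ (All.map (cong suc) (compositions-sum (suc m))))
                                         (All.map⁺ (All.map (λ {c} → sum-incHead c) (compositions-sum (suc m))))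
  where
  sum-incHead : ∀ c → sum c ≡ suc m → sum (incHead c) ≡ suc (suc m)
  sum-incHead (x ∷ c) e = cong suc e

compositions-nonempty : ∀ m → All (λ c → c ≢ []) (compositions (suc m))
compositions-nonempty zero    = (λ ()) ∷ []
compositions-nonempty (suc m) = All.++⁺ (All.map⁺ (All.universal (λ _ ()) (compositions (suc m))))
                                        (All.map⁺ (All.map incHead-nonempty (compositions-nonempty m)))
  where
  incHead-nonempty : ∀ {c} → c ≢ [] → incHead c ≢ []
  incHead-nonempty {[]}    c≢[] = contradiction refl c≢[]
  incHead-nonempty {_ ∷ _} _    = λ ()

incHead-∷ʳ : ∀ {c} y → c ≢ [] → incHead (c ∷ʳ y) ≡ incHead c ∷ʳ y
incHead-∷ʳ {[]}    y c≢[] = contradiction refl c≢[]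
incHead-∷ʳ {_ ∷ _} y _    = refl

∑-compositions-suc : ∀ m (g : List ℕ → ℚ) →
  ∑ (compositions (suc (suc m))) g
    ≡ ∑[ c ∈ compositions (suc m) ] g (1 ∷ c) + ∑[ c ∈ compositions (suc m) ] g (incHead c)
∑-compositions-suc m g =
  trans (∑-++ (map (1 ∷_) C) (map incHead C) g) (cong₂ _+_ (∑-map (1 ∷_) C g) (∑-map incHead C g))
  where C = compositions (suc m)

-- Prepending a part 1 or increasing the first part of a nonempty composition c,
-- with a fixed last part y appended, produces each composition of |c|+1 ending in y once.
extend-front : ∀ k y (g : List ℕ → ℚ) →
  ∑[ c ∈ compositions (suc k) ] (g (1 ∷ (c ∷ʳ y)) + g (incHead (c ∷ʳ y)))
    ≡ ∑[ c ∈ compositions (suc (suc k)) ] g (c ∷ʳ y)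
extend-front k y g = begin
  ∑[ c ∈ C ] (g (1 ∷ (c ∷ʳ y)) + g (incHead (c ∷ʳ y)))
    ≡⟨ ∑-+ C _ _ ⟩
  ∑[ c ∈ C ] g (1 ∷ (c ∷ʳ y)) + ∑[ c ∈ C ] g (incHead (c ∷ʳ y))
    ≡⟨ cong (∑[ c ∈ C ] g (1 ∷ (c ∷ʳ y)) +_)
            (∑-congᴬ (compositions-nonempty k) (λ c c≢[] → cong g (incHead-∷ʳ y c≢[]))) ⟩
  ∑[ c ∈ C ] g (1 ∷ c ∷ʳ y) + ∑[ c ∈ C ] g (incHead c ∷ʳ y)
    ≡⟨ sym (∑-compositions-suc k (λ c → g (c ∷ʳ y))) ⟩
  ∑[ c ∈ compositions (suc (suc k)) ] g (c ∷ʳ y)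
    ∎
  where C = compositions (suc k)

-- Every composition of B > 0 is uniquely  c ++ [B - k]  with c a composition of some k < B.
∑-compositions-by-last : ∀ b (g : List ℕ → ℚ) →
  ∑ (compositions (suc b)) g ≡ ∑[ k ∈ upTo (suc b) ] ∑[ c ∈ compositions k ] g (c ∷ʳ (suc b ∸ k))
∑-compositions-by-last zero    g =
  solve 1 (λ a → a :+ con 0ℚ := (a :+ con 0ℚ) :+ con 0ℚ) refl (g (1 ∷ []))
∑-compositions-by-last (suc b) g = begin
  ∑ (compositions (suc (suc b))) g
    ≡⟨ ∑-compositions-suc b g ⟩
  ∑[ c ∈ compositions (suc b) ] g (1 ∷ c) + ∑[ c ∈ compositions (suc b) ] g (incHead c)
    ≡⟨ cong₂ _+_ (∑-compositions-by-last b (g ∘ (1 ∷_))) (∑-compositions-by-last b (g ∘ incHead)) ⟩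
  ∑[ k ∈ upTo (suc b) ] Front k + ∑[ k ∈ upTo (suc b) ] Head k
    ≡⟨ sym (∑-+ (upTo (suc b)) Front Head) ⟩
  ∑[ k ∈ upTo (suc b) ] (Front k + Head k)
    ≡⟨ ∑-upTo-suc b (λ k → Front k + Head k) ⟩
  (Front 0 + Head 0) + ∑[ k ∈ upTo b ] (Front (suc k) + Head (suc k))
    ≡⟨ cong ((Front 0 + Head 0) +_) (trans (∑-cong (upTo b) (λ k → sym (∑-+ (compositions (suc k)) _ _)))
                                           (∑-cong (upTo b) (λ k → extend-front k (b ∸ k) g))) ⟩
    -- the k = 0 term: c = [] yields  [1, b+1]  and the one-part composition  [b+2]
  ((g (1 ∷ suc b ∷ []) + 0ℚ) + (g (suc (suc b) ∷ []) + 0ℚ)) + Rest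
    ≡⟨ solve 3 (λ p q r → ((p :+ con 0ℚ) :+ (q :+ con 0ℚ)) :+ r := (q :+ con 0ℚ) :+ ((p :+ con 0ℚ) :+ r))
             refl (g (1 ∷ suc b ∷ [])) (g (suc (suc b) ∷ [])) Rest ⟩
  (g (suc (suc b) ∷ []) + 0ℚ) + ((g (1 ∷ suc b ∷ []) + 0ℚ) + Rest)
    ≡⟨ cong (g (suc (suc b) ∷ []) + 0ℚ +_) (sym (∑-upTo-suc b (λ k → Last (suc k)))) ⟩
  (g (suc (suc b) ∷ []) + 0ℚ) + ∑[ k ∈ upTo (suc b) ] Last (suc k)
    ≡⟨ sym (∑-upTo-suc (suc b) Last) ⟩
  ∑[ k ∈ upTo (suc (suc b)) ] Last k
    ∎
  where
  Front Head Last : ℕ → ℚ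
  Front k = ∑[ c ∈ compositions k ] g (1 ∷ (c ∷ʳ (suc b ∸ k)))
  Head  k = ∑[ c ∈ compositions k ] g (incHead (c ∷ʳ (suc b ∸ k)))
  Last  k = ∑[ c ∈ compositions k ] g (c ∷ʳ (suc (suc b) ∸ k))
  Rest : ℚ
  Rest = ∑[ k ∈ upTo b ] Last (suc (suc k))

HasBlockSums : ∀ {k a} → Vec (Fin k) a → List ℕ → (Fin k → ℕ) → Set
HasBlockSums {k} f λ' t = ∀ (j : Fin k) → blockSum f λ' j ≡ t j

admissibleFor : ∀ {k a} → List ℕ → (Fin k → ℕ) → Vec (Fin k) a → Bool
admissibleFor {k} λ' t f = all (λ j → blockSum f λ' j ≡ᵇ t j) (allFin k)

count : (k : ℕ) → List ℕ → (Fin k → ℕ) → ℚ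
count k λ' t = ∑[ f ∈ allVecs (allFin k) (length λ') ] 𝟙ᵇ (admissibleFor λ' t f)

R≡count : ∀ λ' β → ⟦ R λ' β ⟧ ≡ count (length β) λ' (lookup β)
R≡count λ' β = length-filterᵇ (admissible λ' β) (allVecs (allFin (length β)) (length λ'))

admissible⇒ : ∀ {k a} λ' t (f : Vec (Fin k) a) → T (admissibleFor λ' t f) → HasBlockSums f λ' t
admissible⇒ λ' t f h j = ℕ.≡ᵇ⇒≡ _ _ (All.tabulate⁻ (All.all⁺ _ _ h) j)

admissible⇐ : ∀ {k a} λ' t (f : Vec (Fin k) a) → HasBlockSums f λ' t → T (admissibleFor λ' t f)
admissible⇐ λ' t f h = All.all⁻ _ (All.tabulate⁺ (λ j → ℕ.≡⇒≡ᵇ _ _ (h j)))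

reduce : ∀ {k} → (Fin k → ℕ) → Fin k → ℕ → Fin k → ℕ
reduce t y l j = if does (y Fin.≟ j) then t j ∸ l else t j

reduce-here : ∀ {k} (t : Fin k → ℕ) y l → reduce t y l y ≡ t y ∸ l
reduce-here t y l with y Fin.≟ y
... | yes _  = refl
... | no y≢y = contradiction refl y≢y

reduce-elsewhere : ∀ {k} (t : Fin k → ℕ) {y j} l → y ≢ j → reduce t y l j ≡ t j
reduce-elsewhere t {y} {j} l y≢j with y Fin.≟ j
... | yes y≡j = contradiction y≡j y≢j
... | no _    = refl

blockSum-here : ∀ {k a} y (f : Vec (Fin k) a) l ls →
  blockSum (y ∷ f) (l ∷ ls) y ≡ l ℕ.+ blockSum f ls y
blockSum-here y f l ls with y Fin.≟ y
... | yes _  = refl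
... | no y≢y = contradiction refl y≢y

blockSum-elsewhere : ∀ {k a} {y j : Fin k} (f : Vec (Fin k) a) l ls → y ≢ j →
  blockSum (y ∷ f) (l ∷ ls) j ≡ blockSum f ls j
blockSum-elsewhere {y = y} {j} f l ls y≢j with y Fin.≟ j
... | yes y≡j = contradiction y≡j y≢j
... | no _    = refl

blockSums-cons⇒ : ∀ {k a} y (f : Vec (Fin k) a) l ls t →
  HasBlockSums (y ∷ f) (l ∷ ls) t → l ≤ t y × HasBlockSums f ls (reduce t y l)
blockSums-cons⇒ y f l ls t h = l≤ty , rest
  where
  weight-y : l ℕ.+ blockSum f ls y ≡ t y
  weight-y = trans (sym (blockSum-here y f l ls)) (h y)
  l≤ty : l ≤ t y
  l≤ty = subst (l ≤_) weight-y (ℕ.m≤m+n l _)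
  rest : HasBlockSums f ls (reduce t y l)
  rest j with y Fin.≟ j
  ... | yes refl = trans (sym (ℕ.m+n∸m≡n l _)) (cong (_∸ l) weight-y)
  ... | no y≢j   = trans (sym (blockSum-elsewhere f l ls y≢j)) (h j)

blockSums-cons⇐ : ∀ {k a} y (f : Vec (Fin k) a) l ls t →
  l ≤ t y → HasBlockSums f ls (reduce t y l) → HasBlockSums (y ∷ f) (l ∷ ls) t
blockSums-cons⇐ y f l ls t l≤ty h j with y Fin.≟ j
... | yes refl = trans (cong (l ℕ.+_) (trans (h y) (reduce-here t y l))) (ℕ.m+[n∸m]≡n l≤ty)
... | no y≢j   = trans (h j) (reduce-elsewhere t l y≢j)

𝟙-admissible-cons : ∀ {k a} l ls (t : Fin k → ℕ) y (f : Vec (Fin k) a) →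
  𝟙ᵇ (admissibleFor (l ∷ ls) t (y ∷ f)) ≡ 𝟙 (l ℕ.≤? t y) * 𝟙ᵇ (admissibleFor ls (reduce t y l) f)
𝟙-admissible-cons l ls t y f =
  trans (𝟙-⇔ (T? (admissibleFor (l ∷ ls) t (y ∷ f))) (T? ((l ≤ᵇ t y) ∧ admissibleFor ls t′ f)) to from)
        (𝟙ᵇ-∧ (l ≤ᵇ t y) (admissibleFor ls t′ f))
  where
  open Equivalence (Data.Bool.Properties.T-∧ {l ≤ᵇ t y} {admissibleFor ls (reduce t y l) f})
    renaming (to to split-∧; from to join-∧)
  t′ = reduce t y l
  to : T (admissibleFor (l ∷ ls) t (y ∷ f)) → T ((l ≤ᵇ t y) ∧ admissibleFor ls t′ f)
  to h = let (l≤ty , rest) = blockSums-cons⇒ y f l ls t (admissible⇒ (l ∷ ls) t (y ∷ f) h)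
         in  join-∧ (ℕ.≤⇒≤ᵇ l≤ty , admissible⇐ ls t′ f rest)
  from : T ((l ≤ᵇ t y) ∧ admissibleFor ls t′ f) → T (admissibleFor (l ∷ ls) t (y ∷ f))
  from h = let (l≤ty , rest) = split-∧ h
           in  admissible⇐ (l ∷ ls) t (y ∷ f)
                 (blockSums-cons⇐ y f l ls t (ℕ.≤ᵇ⇒≤ l (t y) l≤ty) (admissible⇒ ls t′ f rest))

∑-allFin-suc : ∀ k (G : Fin (suc k) → ℚ) → ∑ (allFin (suc k)) G ≡ G Fin.zero + ∑[ j ∈ allFin k ] G (Fin.suc j)
∑-allFin-suc k G = cong (G Fin.zero +_) (cong sumℚ (trans (map-tabulate Fin.suc G)
                                                          (sym (map-tabulate (λ j → j) (G ∘ Fin.suc)))))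

consTerm : ∀ k → (Fin k → ℕ) → ℕ → List ℕ → Fin k → ℚ
consTerm k t l rest y = 𝟙 (l ℕ.≤? t y) * count k rest (reduce t y l)

count-cons : ∀ k l ls (t : Fin k → ℕ) → count k (l ∷ ls) t ≡ ∑ (allFin k) (consTerm k t l ls)
count-cons k l ls t = begin
  count k (l ∷ ls) t
    ≡⟨ ∑-concatMap (λ y → map (y ∷_) Fs) (allFin k) _ ⟩
  ∑[ y ∈ allFin k ] ∑ (map (y ∷_) Fs) (𝟙ᵇ ∘ admissibleFor (l ∷ ls) t)
    ≡⟨ ∑-cong (allFin k) (λ y → ∑-map (y ∷_) Fs _) ⟩
  ∑[ y ∈ allFin k ] ∑[ f ∈ Fs ] 𝟙ᵇ (admissibleFor (l ∷ ls) t (y ∷ f))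
    ≡⟨ ∑-cong (allFin k) (λ y → ∑-cong Fs (𝟙-admissible-cons l ls t y)) ⟩
  ∑[ y ∈ allFin k ] ∑[ f ∈ Fs ] (𝟙 (l ℕ.≤? t y) * 𝟙ᵇ (admissibleFor ls (reduce t y l) f))
    ≡⟨ ∑-cong (allFin k) (λ y → sym (∑-*ˡ Fs (𝟙 (l ℕ.≤? t y)) _)) ⟩
  ∑ (allFin k) (consTerm k t l ls)
    ∎
  where Fs = allVecs (allFin k) (length ls)

count-cong : ∀ k λ' {t t′ : Fin k → ℕ} → (∀ j → t j ≡ t′ j) → count k λ' t ≡ count k λ' t′
count-cong k λ' {t} {t′} t≗t′ = ∑-cong (allVecs (allFin k) (length λ')) (λ f →
  𝟙-⇔ (T? (admissibleFor λ' t f)) (T? (admissibleFor λ' t′ f))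
      (λ h → admissible⇐ λ' t′ f (λ j → trans (admissible⇒ λ' t f h j) (t≗t′ j)))
      (λ h → admissible⇐ λ' t f (λ j → trans (admissible⇒ λ' t′ f h j) (sym (t≗t′ j)))))

-- A block of target weight 0 stays empty when all parts are positive, so it can be dropped.
count-drop-empty-block : ∀ k λ' (t : Fin (suc k) → ℕ) → All (0 <_) λ' → t Fin.zero ≡ 0 →
  count (suc k) λ' t ≡ count k λ' (t ∘ Fin.suc)
count-drop-empty-block k [] t _ t₀≡0 = cong (_+ 0ℚ)
  (𝟙-⇔ (T? (admissibleFor [] t Vec.[])) (T? (admissibleFor [] (t ∘ Fin.suc) Vec.[]))
       (λ h → admissible⇐ [] (t ∘ Fin.suc) Vec.[] (admissible⇒ [] t Vec.[] h ∘ Fin.suc))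
       (λ h → admissible⇐ [] t Vec.[] λ { Fin.zero    → sym t₀≡0
                                        ; (Fin.suc j) → admissible⇒ [] (t ∘ Fin.suc) Vec.[] h j }))
count-drop-empty-block k (suc l ∷ ls) t (_ ∷ ls>0) t₀≡0 = begin
  count (suc k) (suc l ∷ ls) t
    ≡⟨ trans (count-cons (suc k) (suc l) ls t) (∑-allFin-suc k (consTerm (suc k) t (suc l) ls)) ⟩
  consTerm (suc k) t (suc l) ls Fin.zero + ∑[ y ∈ allFin k ] consTerm (suc k) t (suc l) ls (Fin.suc y)
    ≡⟨ cong₂ _+_ no-room-in-block-0 (∑-cong (allFin k) other-block) ⟩
  0ℚ + ∑ (allFin k) (consTerm k (t ∘ Fin.suc) (suc l) ls)
    ≡⟨ trans (ℚ.+-identityˡ _) (sym (count-cons k (suc l) ls (t ∘ Fin.suc))) ⟩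
  count k (suc l ∷ ls) (t ∘ Fin.suc)
    ∎
  where
  no-room-in-block-0 : consTerm (suc k) t (suc l) ls Fin.zero ≡ 0ℚ
  no-room-in-block-0 = trans (cong (_* count (suc k) ls (reduce t Fin.zero (suc l)))
                                   (𝟙-no (suc l ℕ.≤? t Fin.zero) (λ l<t₀ → ℕ.n≮0 (subst (suc l ≤_) t₀≡0 l<t₀))))
                             (ℚ.*-zeroˡ (count (suc k) ls (reduce t Fin.zero (suc l))))
  other-block : ∀ y → consTerm (suc k) t (suc l) ls (Fin.suc y) ≡ consTerm k (t ∘ Fin.suc) (suc l) ls y
  other-block y = cong (𝟙 (suc l ℕ.≤? t (Fin.suc y)) *_)
    (trans (count-drop-empty-block k ls (reduce t (Fin.suc y) (suc l)) ls>0 t₀≡0) (count-cong k ls (λ j → refl)))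

reduce-comm : ∀ {k} (t : Fin k → ℕ) y x z l j → reduce (reduce t y x) z l j ≡ reduce (reduce t z l) y x j
reduce-comm t y x z l j with y Fin.≟ j | z Fin.≟ j
... | yes _ | yes _ = trans (ℕ.∸-+-assoc (t j) x l)
                        (trans (cong (t j ∸_) (ℕ.+-comm x l)) (sym (ℕ.∸-+-assoc (t j) l x)))
... | yes _ | no _  = refl
... | no _  | yes _ = refl
... | no _  | no _  = refl

fits-swap : ∀ {x l m} → x ≤ m → l ≤ m ∸ x → x ≤ m ∸ l
fits-swap {x} {l} {m} x≤m l≤m∸x =
  ℕ.m+n≤o⇒m≤o∸n x (subst (_≤ m) (ℕ.+-comm l x) (ℕ.m≤o∸n⇒m+n≤o l x≤m l≤m∸x))

𝟙-fits-swap : ∀ x l m → 𝟙 (x ℕ.≤? m) * 𝟙 (l ℕ.≤? m ∸ x) ≡ 𝟙 (l ℕ.≤? m) * 𝟙 (x ℕ.≤? m ∸ l)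
𝟙-fits-swap x l m = begin
  𝟙 (x ℕ.≤? m) * 𝟙 (l ℕ.≤? m ∸ x)         ≡⟨ sym (𝟙-× (x ℕ.≤? m) (l ℕ.≤? m ∸ x)) ⟩
  𝟙 (x ℕ.≤? m ×-dec l ℕ.≤? m ∸ x)         ≡⟨ 𝟙-⇔ (x ℕ.≤? m ×-dec l ℕ.≤? m ∸ x) (l ℕ.≤? m ×-dec x ℕ.≤? m ∸ l)
                                                  (both x l) (both l x) ⟩
  𝟙 (l ℕ.≤? m ×-dec x ℕ.≤? m ∸ l)         ≡⟨ 𝟙-× (l ℕ.≤? m) (x ℕ.≤? m ∸ l) ⟩
  𝟙 (l ℕ.≤? m) * 𝟙 (x ℕ.≤? m ∸ l)         ∎
  where
  both : ∀ a b → a ≤ m × b ≤ m ∸ a → b ≤ m × a ≤ m ∸ b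
  both a b (a≤m , b≤m∸a) = ℕ.≤-trans b≤m∸a (ℕ.m∸n≤m m a) , fits-swap a≤m b≤m∸a

𝟙-fits-split : ∀ l m → 𝟙 (l ℕ.≤? m) * ⟦ m ⟧ ≡ 𝟙 (l ℕ.≤? m) * (⟦ l ⟧ + ⟦ m ∸ l ⟧)
𝟙-fits-split l m =
  𝟙-*-cong (l ℕ.≤? m) (λ l≤m → trans (cong ⟦_⟧ (sym (ℕ.m+[n∸m]≡n l≤m))) (⟦⟧-homo-+ l (m ∸ l)))

pickOne : List ℕ → List (ℕ × List ℕ)
pickOne []       = []
pickOne (l ∷ ls) = (l , ls) ∷ map (Product.map₂ (l ∷_)) (pickOne ls)

-- Double counting over the first block B_0 of weight t_0:
--   t_0 · #{admissible f} = ∑_i λ_i · #{admissible f with f(i) = 0},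
-- where assignments with f(i) = 0 are admissible assignments of the other parts for the target
-- with t_0 reduced by λ_i.
pickWeight : ∀ {k} → (Fin (suc k) → ℕ) → ℕ → ℚ
pickWeight t x = 𝟙 (x ℕ.≤? t Fin.zero) * ⟦ x ⟧

pickTerm : ∀ k → (Fin (suc k) → ℕ) → ℕ × List ℕ → ℚ
pickTerm k t (x , rest) = pickWeight t x * count (suc k) rest (reduce t Fin.zero x)

WeightedCount : ℕ → List ℕ → Set
WeightedCount k λ' = ∀ t → ⟦ t Fin.zero ⟧ * count (suc k) λ' t ≡ ∑ (pickOne λ') (pickTerm k t)

-- In the inductive step for l ∷ ls both orders of the two choices appear: pick x (from ls)
-- into block 0, then place l into block y.
pickThenPlace : ∀ k → (Fin (suc k) → ℕ) → ℕ → Fin (suc k) → ℕ × List ℕ → ℚ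
pickThenPlace k t l y (x , rest) = pickWeight t x * consTerm (suc k) (reduce t Fin.zero x) l rest y

-- The part l placed into block 0: split t_0 = l + (t_0 - l) and use the hypothesis for ls.
weighted-first-block : ∀ k l ls (t : Fin (suc k) → ℕ) → WeightedCount k ls →
  ⟦ t Fin.zero ⟧ * consTerm (suc k) t l ls Fin.zero
    ≡ pickTerm k t (l , ls) + ∑ (pickOne ls) (pickThenPlace k t l Fin.zero)
weighted-first-block k l ls t ih = begin
  ⟦ t₀ ⟧ * (𝟙 (l ℕ.≤? t₀) * C ls t′)
    ≡⟨ solve 3 (λ m i c → m :* (i :* c) := (i :* m) :* c) refl ⟦ t₀ ⟧ (𝟙 (l ℕ.≤? t₀)) (C ls t′) ⟩
  (𝟙 (l ℕ.≤? t₀) * ⟦ t₀ ⟧) * C ls t′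
    ≡⟨ cong (_* C ls t′) (𝟙-fits-split l t₀) ⟩
  (𝟙 (l ℕ.≤? t₀) * (⟦ l ⟧ + ⟦ t₀ ∸ l ⟧)) * C ls t′
    ≡⟨ solve 4 (λ i a b c → (i :* (a :+ b)) :* c := i :* a :* c :+ i :* (b :* c))
               refl (𝟙 (l ℕ.≤? t₀)) ⟦ l ⟧ ⟦ t₀ ∸ l ⟧ (C ls t′) ⟩
  pickTerm k t (l , ls) + 𝟙 (l ℕ.≤? t₀) * (⟦ t₀ ∸ l ⟧ * C ls t′)
    ≡⟨ cong (λ z → pickTerm k t (l , ls) + 𝟙 (l ℕ.≤? t₀) * z) (ih t′) ⟩
  pickTerm k t (l , ls) + 𝟙 (l ℕ.≤? t₀) * ∑ (pickOne ls) (pickTerm k t′)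
    ≡⟨ cong (pickTerm k t (l , ls) +_)
            (trans (∑-*ˡ (pickOne ls) (𝟙 (l ℕ.≤? t₀)) (pickTerm k t′)) (∑-cong (pickOne ls) reorder)) ⟩
  pickTerm k t (l , ls) + ∑ (pickOne ls) (pickThenPlace k t l Fin.zero)
    ∎
  where
  t₀ = t Fin.zero
  t′ = reduce t Fin.zero l
  C = count (suc k)
  reorder : ∀ p → 𝟙 (l ℕ.≤? t₀) * pickTerm k t′ p ≡ pickThenPlace k t l Fin.zero p
  reorder (x , r) = begin
    𝟙 (l ℕ.≤? t₀) * (𝟙 (x ℕ.≤? t₀ ∸ l) * ⟦ x ⟧ * C r (reduce t′ Fin.zero x))
      ≡⟨ solve 4 (λ a b c d → a :* (b :* c :* d) := (a :* b) :* c :* d) refl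
           (𝟙 (l ℕ.≤? t₀)) (𝟙 (x ℕ.≤? t₀ ∸ l)) ⟦ x ⟧ (C r (reduce t′ Fin.zero x)) ⟩
    (𝟙 (l ℕ.≤? t₀) * 𝟙 (x ℕ.≤? t₀ ∸ l)) * ⟦ x ⟧ * C r (reduce t′ Fin.zero x)
      ≡⟨ cong₂ (λ u v → u * ⟦ x ⟧ * v) (sym (𝟙-fits-swap x l t₀))
                                        (count-cong (suc k) r (reduce-comm t Fin.zero l Fin.zero x)) ⟩
    (𝟙 (x ℕ.≤? t₀) * 𝟙 (l ℕ.≤? t₀ ∸ x)) * ⟦ x ⟧ * C r (reduce (reduce t Fin.zero x) Fin.zero l)
      ≡⟨ solve 4 (λ a b c d → (a :* b) :* c :* d := (a :* c) :* (b :* d)) refl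
           (𝟙 (x ℕ.≤? t₀)) (𝟙 (l ℕ.≤? t₀ ∸ x)) ⟦ x ⟧ (C r (reduce (reduce t Fin.zero x) Fin.zero l)) ⟩
    pickThenPlace k t l Fin.zero (x , r)
      ∎

-- The part l placed into another block y+1: block 0 is untouched, so the hypothesis applies directly.
weighted-other-block : ∀ k l ls (t : Fin (suc k) → ℕ) y → WeightedCount k ls →
  ⟦ t Fin.zero ⟧ * consTerm (suc k) t l ls (Fin.suc y) ≡ ∑ (pickOne ls) (pickThenPlace k t l (Fin.suc y))
weighted-other-block k l ls t y ih = begin
  ⟦ t₀ ⟧ * (𝟙 (l ℕ.≤? tᵧ) * C ls t′)
    ≡⟨ solve 3 (λ m i c → m :* (i :* c) := i :* (m :* c)) refl ⟦ t₀ ⟧ (𝟙 (l ℕ.≤? tᵧ)) (C ls t′) ⟩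
  𝟙 (l ℕ.≤? tᵧ) * (⟦ t₀ ⟧ * C ls t′)
    ≡⟨ cong (𝟙 (l ℕ.≤? tᵧ) *_) (ih t′) ⟩
  𝟙 (l ℕ.≤? tᵧ) * ∑ (pickOne ls) (pickTerm k t′)
    ≡⟨ trans (∑-*ˡ (pickOne ls) (𝟙 (l ℕ.≤? tᵧ)) (pickTerm k t′)) (∑-cong (pickOne ls) reorder) ⟩
  ∑ (pickOne ls) (pickThenPlace k t l (Fin.suc y))
    ∎
  where
  t₀ = t Fin.zero
  tᵧ = t (Fin.suc y)
  t′ = reduce t (Fin.suc y) l
  C = count (suc k)
  reorder : ∀ p → 𝟙 (l ℕ.≤? tᵧ) * pickTerm k t′ p ≡ pickThenPlace k t l (Fin.suc y) p
  reorder (x , r) =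
    trans (solve 3 (λ i w c → i :* (w :* c) := w :* (i :* c))
                   refl (𝟙 (l ℕ.≤? tᵧ)) (pickWeight t x) (C r (reduce t′ Fin.zero x)))
          (cong (λ z → pickWeight t x * (𝟙 (l ℕ.≤? tᵧ) * z))
                (count-cong (suc k) r (reduce-comm t (Fin.suc y) l Fin.zero x)))

∑-pickThenPlace : ∀ k t l p → ∑ (allFin (suc k)) (λ y → pickThenPlace k t l y p) ≡ pickTerm k t (proj₁ p , l ∷ proj₂ p)
∑-pickThenPlace k t l (x , r) = begin
  ∑[ y ∈ allFin (suc k) ] (pickWeight t x * consTerm (suc k) (reduce t Fin.zero x) l r y)
    ≡⟨ sym (∑-*ˡ (allFin (suc k)) (pickWeight t x) (consTerm (suc k) (reduce t Fin.zero x) l r)) ⟩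
  pickWeight t x * ∑ (allFin (suc k)) (consTerm (suc k) (reduce t Fin.zero x) l r)
    ≡⟨ cong (pickWeight t x *_) (sym (count-cons (suc k) l r (reduce t Fin.zero x))) ⟩
  pickTerm k t (x , l ∷ r)
    ∎

weighted-count : ∀ k λ' → WeightedCount k λ'
weighted-count k [] t with t Fin.zero ℕ.≟ 0
... | yes t₀≡0 = trans (cong (λ m → ⟦ m ⟧ * count (suc k) [] t) t₀≡0) (ℚ.*-zeroˡ (count (suc k) [] t))
... | no  t₀≢0 = trans (cong (λ c → ⟦ t Fin.zero ⟧ * (c + 0ℚ)) (𝟙-no (T? (admissibleFor [] t Vec.[])) block-0-nonempty))
                       (ℚ.*-zeroʳ ⟦ t Fin.zero ⟧)
  where
  block-0-nonempty : ¬ T (admissibleFor [] t Vec.[])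
  block-0-nonempty h = t₀≢0 (sym (admissible⇒ [] t Vec.[] h Fin.zero))
weighted-count k (l ∷ ls) t = begin
  ⟦ t₀ ⟧ * count (suc k) (l ∷ ls) t
    ≡⟨ trans (cong (⟦ t₀ ⟧ *_) (count-cons (suc k) l ls t)) (∑-*ˡ (allFin (suc k)) ⟦ t₀ ⟧ (consTerm (suc k) t l ls)) ⟩
  ∑[ y ∈ allFin (suc k) ] (⟦ t₀ ⟧ * consTerm (suc k) t l ls y)
    ≡⟨ ∑-allFin-suc k (λ y → ⟦ t₀ ⟧ * consTerm (suc k) t l ls y) ⟩
  ⟦ t₀ ⟧ * consTerm (suc k) t l ls Fin.zero + ∑[ y ∈ allFin k ] (⟦ t₀ ⟧ * consTerm (suc k) t l ls (Fin.suc y))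
    ≡⟨ cong₂ _+_ (weighted-first-block k l ls t ih)
                 (trans (∑-cong (allFin k) (λ y → weighted-other-block k l ls t y ih))
                        (∑-swap (allFin k) (pickOne ls) (λ y → pickThenPlace k t l (Fin.suc y)))) ⟩
  (pickTerm k t (l , ls) + ∑ (pickOne ls) (Place Fin.zero)) + ∑[ p ∈ pickOne ls ] ∑[ y ∈ allFin k ] Place (Fin.suc y) p
    ≡⟨ trans (ℚ.+-assoc (pickTerm k t (l , ls)) (∑ (pickOne ls) (Place Fin.zero)) _)
             (cong (pickTerm k t (l , ls) +_) (sym (∑-+ (pickOne ls) (Place Fin.zero) _))) ⟩
  pickTerm k t (l , ls) + ∑[ p ∈ pickOne ls ] (Place Fin.zero p + ∑[ y ∈ allFin k ] Place (Fin.suc y) p)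
    ≡⟨ cong (pickTerm k t (l , ls) +_) (∑-cong (pickOne ls) (λ p →
         trans (sym (∑-allFin-suc k (λ y → Place y p))) (∑-pickThenPlace k t l p))) ⟩
  pickTerm k t (l , ls) + ∑[ (x , r) ∈ pickOne ls ] pickTerm k t (x , l ∷ r)
    ≡⟨ cong (pickTerm k t (l , ls) +_) (sym (∑-map (Product.map₂ (l ∷_)) (pickOne ls) (pickTerm k t))) ⟩
  ∑ (pickOne (l ∷ ls)) (pickTerm k t)
    ∎
  where
  t₀ = t Fin.zero
  ih = weighted-count k ls
  Place = pickThenPlace k t l

Desc : List ℕ → Set
Desc = Linked (λ x y → y ≤ x)

private
  ≥-order = decTotalOrder ℕ.≤-decTotalOrder
  module Sort = Data.List.Sort.InsertionSort.Properties ≥-order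

sorted-unique : ∀ {xs ys} → Desc xs → Desc ys → xs ↭ ys → xs ≡ ys
sorted-unique xs↘ ys↘ xs↭ys = Pointwise-≡⇒≡ (↗↭↗⇒≋ (DecTotalOrder.totalOrder ≥-order) xs↘ ys↘
                                                    (↭⇒↭ₛ′ (DecTotalOrder.Eq.isEquivalence ≥-order) xs↭ys))

sort≡⇒↭ : ∀ {u λ'} → sortDesc u ≡ λ' → u ↭ λ'
sort≡⇒↭ {u} refl = ↭-sym (Sort.sort-↭ u)

↭⇒sort≡ : ∀ {u λ'} → Desc λ' → u ↭ λ' → sortDesc u ≡ λ'
↭⇒sort≡ {u} λ↘ u↭λ = sorted-unique (Sort.sort-↗ u) λ↘ (↭-trans (Sort.sort-↭ u) u↭λ)

delete : ℕ → List ℕ → List ℕ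
delete x []       = []
delete x (y ∷ ys) with x ℕ.≟ y
... | yes _ = ys
... | no  _ = y ∷ delete x ys

delete-head : ∀ x ys → delete x (x ∷ ys) ≡ ys
delete-head x ys with x ℕ.≟ x
... | yes _  = refl
... | no x≢x = contradiction refl x≢x

delete-↭ : ∀ {x λ'} → x ∈ λ' → λ' ↭ x ∷ delete x λ'
delete-↭ {x} {y ∷ ys} (here refl) rewrite delete-head x ys = ↭-refl
delete-↭ {x} {y ∷ ys} (there x∈ys) with x ℕ.≟ y
... | yes refl = ↭-refl
... | no  _    = ↭-trans (prep y (delete-↭ x∈ys)) (swap y x ↭-refl)

head-≥ : ∀ {h hs x} → Desc (h ∷ hs) → x ∈ hs → x ≤ h
head-≥ (h≥y ∷ _)  (here refl) = h≥y
head-≥ (h≥y ∷ hs↘) (there x∈) = ℕ.≤-trans (head-≥ hs↘ x∈) h≥y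

desc-tail : ∀ {h hs} → Desc (h ∷ hs) → Desc hs
desc-tail [-]       = []
desc-tail (_ ∷ hs↘) = hs↘

desc-delete-below : ∀ {y} x ys → Desc (y ∷ ys) → Desc (y ∷ delete x ys)
desc-delete-below x []       _ = [-]
desc-delete-below x (z ∷ zs) (y≥z ∷ zs↘) with x ℕ.≟ z
desc-delete-below x (z ∷ [])     (y≥z ∷ _)          | yes _ = [-]
desc-delete-below x (z ∷ w ∷ ws) (y≥z ∷ z≥w ∷ ws↘) | yes _ = ℕ.≤-trans z≥w y≥z ∷ ws↘
... | no _ = y≥z ∷ desc-delete-below x zs zs↘

desc-delete : ∀ x λ' → Desc λ' → Desc (delete x λ')
desc-delete x []       λ↘ = λ↘
desc-delete x (y ∷ ys) λ↘ with x ℕ.≟ y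
... | yes _ = desc-tail λ↘
... | no  _ = desc-delete-below x ys λ↘

-- In a decreasing list equal values are adjacent, so deleting the head or the first
-- later occurrence of a value gives the same list.
delete-under-head : ∀ {l x} ls → Desc (l ∷ ls) → x ∈ ls → l ∷ delete x ls ≡ delete x (l ∷ ls)
delete-under-head {l} {x} ls λ↘ x∈ls with x ℕ.≟ l
... | no _ = refl
delete-under-head {l} {.l} (h ∷ hs) (l≥h ∷ hs↘) l∈ | yes refl with l ℕ.≟ h
... | yes refl = refl
... | no  l≢h  = contradiction (ℕ.≤-antisym l≥h (l≤h l∈)) (l≢h ∘ sym)
  where
  l≤h : l ∈ h ∷ hs → l ≤ h
  l≤h (here refl) = ℕ.≤-refl
  l≤h (there l∈hs) = head-≥ hs↘ l∈hs

sort-remove⇒ : ∀ {x λ'} u v → Desc λ' → sortDesc (u ++ x ∷ v) ≡ λ' → x ∈ λ' × sortDesc (u ++ v) ≡ delete x λ'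
sort-remove⇒ {x} {λ'} u v λ↘ sorted = x∈λ , ↭⇒sort≡ (desc-delete x λ' λ↘) (drop-∷ x∷u++v↭)
  where
  u++x∷v↭λ : u ++ x ∷ v ↭ λ'
  u++x∷v↭λ = sort≡⇒↭ sorted
  x∈λ : x ∈ λ'
  x∈λ = ∈-resp-↭ u++x∷v↭λ (∈-insert u)
  x∷u++v↭ : x ∷ (u ++ v) ↭ x ∷ delete x λ'
  x∷u++v↭ = ↭-trans (↭-sym (shift x u v)) (↭-trans u++x∷v↭λ (delete-↭ x∈λ))

sort-remove⇐ : ∀ {x λ'} u v → Desc λ' → x ∈ λ' → sortDesc (u ++ v) ≡ delete x λ' → sortDesc (u ++ x ∷ v) ≡ λ'
sort-remove⇐ {x} u v λ↘ x∈λ sorted =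
  ↭⇒sort≡ λ↘ (↭-trans (shift x u v) (↭-trans (prep x (sort≡⇒↭ sorted)) (↭-sym (delete-↭ x∈λ))))

length-filter-cons : ∀ {P : A → Set} (P? : ∀ x → Dec (P x)) y ys →
  ⟦ length (filter P? (y ∷ ys)) ⟧ ≡ 𝟙 (P? y) + ⟦ length (filter P? ys) ⟧
length-filter-cons P? y ys with does (P? y)
... | true  = ⟦⟧-homo-+ 1 (length (filter P? ys))
... | false = sym (ℚ.+-identityˡ _)

mult-cons : ∀ x l ls → ⟦ mult x (l ∷ ls) ⟧ ≡ 𝟙 (x ℕ.≟ l) + ⟦ mult x ls ⟧
mult-cons x = length-filter-cons (x ℕ.≟_)

mult-here : ∀ {x y} ys → x ≡ y → mult x (y ∷ ys) ≡ suc (mult x ys)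
mult-here {x} ys x≡y = cong length (filter-accept (x ℕ.≟_) x≡y)

mult-elsewhere : ∀ {x y} ys → x ≢ y → mult x (y ∷ ys) ≡ mult x ys
mult-elsewhere {x} ys x≢y = cong length (filter-reject (x ℕ.≟_) x≢y)

mult-delete-same : ∀ {x λ'} → x ∈ λ' → mult x λ' ≡ suc (mult x (delete x λ'))
mult-delete-same {x} {y ∷ ys} x∈ with x ℕ.≟ y
mult-delete-same {x} {y ∷ ys} x∈          | yes x≡y = mult-here ys x≡y
mult-delete-same {x} {y ∷ ys} (here x≡y)  | no  x≢y = contradiction x≡y x≢y
mult-delete-same {x} {y ∷ ys} (there x∈)  | no  x≢y =
  trans (mult-elsewhere ys x≢y) (trans (mult-delete-same x∈) (cong suc (sym (mult-elsewhere (delete x ys) x≢y))))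

mult-delete-other : ∀ {i x} λ' → i ≢ x → mult i (delete x λ') ≡ mult i λ'
mult-delete-other []                 _   = refl
mult-delete-other {i} {x} (y ∷ ys) i≢x with x ℕ.≟ y
... | yes refl = sym (mult-elsewhere ys i≢x)
... | no  _    with i ℕ.≟ y
...   | yes i≡y = trans (mult-here (delete x ys) i≡y)
                        (trans (cong suc (mult-delete-other ys i≢x)) (sym (mult-here ys i≡y)))
...   | no  i≢y = trans (mult-elsewhere (delete x ys) i≢y)
                        (trans (mult-delete-other ys i≢x) (sym (mult-elsewhere ys i≢y)))

mult-∉ : ∀ {x λ'} → ¬ x ∈ λ' → mult x λ' ≡ 0
mult-∉ {x} x∉λ = cong length (filter-none (x ℕ.≟_) (All.¬Any⇒All¬ _ x∉λ))

length-delete : ∀ {x} λ' → x ∈ λ' → length λ' ≡ suc (length (delete x λ'))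
length-delete {x} (y ∷ ys) x∈ with x ℕ.≟ y
length-delete {x} (y ∷ ys) x∈         | yes _   = refl
length-delete {x} (y ∷ ys) (here x≡y) | no  x≢y = contradiction x≡y x≢y
length-delete {x} (y ∷ ys) (there x∈) | no  _   = cong suc (length-delete ys x∈)

all-delete : ∀ {P : ℕ → Set} x λ' → All P λ' → All P (delete x λ')
all-delete x []       pxs        = pxs
all-delete x (y ∷ ys) (py ∷ pys) with x ℕ.≟ y
... | yes _ = pys
... | no  _ = py ∷ all-delete x ys pys

-- The centraliser order  z_λ = ∏_{1 ≤ i ≤ N} i^{m_i} m_i!,  for any bound N on the parts
-- (zee λ is the case N = |λ|).

zFactor : List ℕ → ℕ → ℕ
zFactor λ' i = (i ^ mult i λ') ℕ.* mult i λ' !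

zBounded : ℕ → List ℕ → ℕ
zBounded N λ' = product (map (zFactor λ') (map suc (upTo N)))

product-update : ∀ {xs x} c (g g′ : ℕ → ℕ) → Unique xs → x ∈ xs →
  (∀ i → i ≢ x → g i ≡ g′ i) → g x ≡ c ℕ.* g′ x → product (map g xs) ≡ c ℕ.* product (map g′ xs)
product-update {i ∷ xs} {x} c g g′ (i∉xs ∷ _) (here refl) g≗g′ gx≡ =
  trans (cong₂ ℕ._*_ gx≡ (agree xs (All.map (λ i≢j j≡i → i≢j (sym j≡i)) i∉xs))) (ℕ.*-assoc c (g′ x) _)
  where
  agree : ∀ js → All (_≢ x) js → product (map g js) ≡ product (map g′ js)
  agree []       _            = refl
  agree (j ∷ js) (j≢x ∷ js≢x) = cong₂ ℕ._*_ (g≗g′ j j≢x) (agree js js≢x)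
product-update {i ∷ xs} {x} c g g′ (i∉xs ∷ xs!) (there x∈) g≗g′ gx≡ with i ℕ.≟ x
... | yes refl = contradiction x∈ (λ i∈xs → All.lookup i∉xs i∈xs refl)
... | no  i≢x  = trans (cong₂ ℕ._*_ (g≗g′ i i≢x) (product-update c g g′ xs! x∈ g≗g′ gx≡))
                       (ℕsolve 3 (λ a b p → a ℕ:* (b ℕ:* p) ℕ:= b ℕ:* (a ℕ:* p)) refl (g′ i) c (product (map g′ xs)))

zBounded-delete : ∀ {N x} λ' → 0 < x → x ≤ N → x ∈ λ' →
  zBounded N λ' ≡ (x ℕ.* mult x λ') ℕ.* zBounded N (delete x λ')
zBounded-delete {N} {suc x′} λ' (s≤s _) x≤N x∈ =
  product-update (x ℕ.* mult x λ') (zFactor λ') (zFactor (delete x λ'))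
    (Unique.map⁺ ℕ.suc-injective (Unique.upTo⁺ N)) (∈-map⁺ suc (∈-upTo⁺ x≤N))
    (λ i i≢x → cong (λ m → (i ^ m) ℕ.* m !) (sym (mult-delete-other λ' i≢x))) factor-x
  where
  x = suc x′
  m = mult x (delete x λ')
  factor-x : zFactor λ' x ≡ (x ℕ.* mult x λ') ℕ.* zFactor (delete x λ') x
  factor-x = begin
    (x ^ mult x λ') ℕ.* mult x λ' !       ≡⟨ cong (λ k → (x ^ k) ℕ.* k !) (mult-delete-same x∈) ⟩
    (x ℕ.* x ^ m) ℕ.* (suc m ℕ.* m !)     ≡⟨ interchange x (x ^ m) (suc m) (m !) ⟩
    (x ℕ.* suc m) ℕ.* ((x ^ m) ℕ.* m !)   ≡⟨ cong (λ k → (x ℕ.* k) ℕ.* zFactor (delete x λ') x)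
                                                   (sym (mult-delete-same x∈)) ⟩
    (x ℕ.* mult x λ') ℕ.* zFactor (delete x λ') x ∎
    where
    interchange : ∀ a p b f → (a ℕ.* p) ℕ.* (b ℕ.* f) ≡ (a ℕ.* b) ℕ.* (p ℕ.* f)
    interchange = ℕsolve 4 (λ a p b f → (a ℕ:* p) ℕ:* (b ℕ:* f) ℕ:= (a ℕ:* b) ℕ:* (p ℕ:* f)) refl

zBounded-[] : ∀ N → zBounded N [] ≡ 1
zBounded-[] N = go (map suc (upTo N))
  where
  go : ∀ is → product (map (zFactor []) is) ≡ 1
  go []       = refl
  go (i ∷ is) = trans (ℕ.*-identityˡ _) (go is)

zBounded-nonZero : ∀ N λ' → ℕ.NonZero (zBounded N λ')
zBounded-nonZero N λ' = product≢0 (All.map⁺ (All.map⁺ (All.universal factor-nonZero (upTo N))))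
  where
  factor-nonZero : ∀ i → ℕ.NonZero (zFactor λ' (suc i))
  factor-nonZero i = ℕ.m*n≢0 _ _ {{ℕ.m^n≢0 (suc i) (mult (suc i) λ')}} {{mult (suc i) λ' ℕ.!≢0}}

sortsTo? : (α λ' : List ℕ) → Dec (sortDesc α ≡ λ')
sortsTo? α λ' = ≡-dec ℕ._≟_ (sortDesc α) λ'

refinementTerm : List ℕ → List (List ℕ) → ℚ
refinementTerm λ' bs = 𝟙 (sortsTo? (concat bs) λ') * inv (πblocks bs)

refinementSum : List ℕ → List ℕ → ℚ
refinementSum λ' β = ∑ (refinements β) (refinementTerm λ')

rhs≡n!*refinementSum : ∀ n λ' β → rhs n λ' β ≡ ⟦ n ! ⟧ * refinementSum λ' β
rhs≡n!*refinementSum n λ' β = begin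
  rhs n λ' β
    ≡⟨ ∑-filter (λ bs → sortsTo? (concat bs) λ') (refinements β) (λ bs → ratio (n !) (πblocks bs)) ⟩
  ∑[ bs ∈ refinements β ] (𝟙 (sortsTo? (concat bs) λ') * ratio (n !) (πblocks bs))
    ≡⟨ ∑-cong (refinements β) pull-out-n! ⟩
  ∑[ bs ∈ refinements β ] (⟦ n ! ⟧ * refinementTerm λ' bs)
    ≡⟨ sym (∑-*ˡ (refinements β) ⟦ n ! ⟧ (refinementTerm λ')) ⟩
  ⟦ n ! ⟧ * refinementSum λ' β
    ∎
  where
  pull-out-n! : ∀ bs → 𝟙 (sortsTo? (concat bs) λ') * ratio (n !) (πblocks bs) ≡ ⟦ n ! ⟧ * refinementTerm λ' bs
  pull-out-n! bs =
    trans (cong (𝟙 (sortsTo? (concat bs) λ') *_) (ratio≡⟦⟧*inv (n !) (πblocks bs)))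
          (solve 3 (λ i f p → i :* (f :* p) := f :* (i :* p)) refl (𝟙 (sortsTo? (concat bs) λ')) ⟦ n ! ⟧ (inv (πblocks bs)))

refinementSum-cons : ∀ λ' b bs →
  refinementSum λ' (b ∷ bs) ≡ ∑[ c ∈ compositions b ] ∑[ r ∈ refinements bs ] refinementTerm λ' (c ∷ r)
refinementSum-cons λ' b bs =
  trans (∑-concatMap (λ c → map (c ∷_) (refinements bs)) (compositions b) (refinementTerm λ'))
        (∑-cong (compositions b) (λ c → ∑-map (c ∷_) (refinements bs) (refinementTerm λ')))

-- A zero part of β contributes an empty block, which changes neither α nor π.
refinementSum-zero : ∀ λ' bs → refinementSum λ' (0 ∷ bs) ≡ refinementSum λ' bs
refinementSum-zero λ' bs = trans (refinementSum-cons λ' 0 bs) (trans (ℚ.+-identityʳ _) (∑-cong (refinements bs) empty-block))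
  where
  empty-block : ∀ r → refinementTerm λ' ([] ∷ r) ≡ refinementTerm λ' r
  empty-block r = cong (λ p → 𝟙 (sortsTo? (concat r) λ') * inv p) (ℕ.+-identityʳ (πblocks r))

𝟙-sort-remove : ∀ {x λ'} u v → Desc λ' →
  𝟙 (sortsTo? (u ++ x ∷ v) λ') ≡ 𝟙 (x ∈? λ') * 𝟙 (sortsTo? (u ++ v) (delete x λ'))
𝟙-sort-remove {x} {λ'} u v λ↘ with x ∈? λ'
... | yes x∈λ = trans (𝟙-⇔ (sortsTo? (u ++ x ∷ v) λ') removed
                           (proj₂ ∘ sort-remove⇒ u v λ↘) (sort-remove⇐ u v λ↘ x∈λ))
                      (sym (ℚ.*-identityˡ (𝟙 removed)))
  where removed = sortsTo? (u ++ v) (delete x λ')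
... | no  x∉λ = trans (𝟙-no (sortsTo? (u ++ x ∷ v) λ') (x∉λ ∘ proj₁ ∘ sort-remove⇒ u v λ↘))
                      (sym (ℚ.*-zeroˡ (𝟙 (sortsTo? (u ++ v) (delete x λ')))))

π-snoc : ∀ a c x → πacc a (c ∷ʳ x) ≡ πacc a c ℕ.* (a ℕ.+ sum c ℕ.+ x)
π-snoc a []      x = ℕsolve 2 (λ a x → (a ℕ:+ x) ℕ:* ℕcon 1 ℕ:= ℕcon 1 ℕ:* ((a ℕ:+ ℕcon 0) ℕ:+ x)) refl a x
π-snoc a (y ∷ c) x = trans (cong ((a ℕ.+ y) ℕ.*_) (π-snoc (a ℕ.+ y) c x))
  (ℕsolve 5 (λ a y p s x → (a ℕ:+ y) ℕ:* (p ℕ:* ((a ℕ:+ y) ℕ:+ s ℕ:+ x)) ℕ:= ((a ℕ:+ y) ℕ:* p) ℕ:* (a ℕ:+ (y ℕ:+ s) ℕ:+ x))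
            refl a y (πacc (a ℕ.+ y) c) (sum c) x)

remove-last-part : ∀ {λ'} b c x r → Desc λ' → sum c ℕ.+ x ≡ suc b →
  ⟦ suc b ⟧ * refinementTerm λ' ((c ∷ʳ x) ∷ r) ≡ 𝟙 (x ∈? λ') * refinementTerm (delete x λ') (c ∷ r)
remove-last-part {λ'} b c x r λ↘ |c|+x≡B = begin
  ⟦ B ⟧ * (𝟙 (sortsTo? ((c ∷ʳ x) ++ concat r) λ') * inv (πc (c ∷ʳ x) ℕ.* P))
    ≡⟨ cong₂ (λ i p → ⟦ B ⟧ * (i * inv p))
             (trans (cong (λ α → 𝟙 (sortsTo? α λ')) (++-assoc c (x ∷ []) (concat r)))
                    (𝟙-sort-remove c (concat r) λ↘))
             π-last ⟩
  ⟦ B ⟧ * ((𝟙 (x ∈? λ') * I′) * inv ((πc c ℕ.* P) ℕ.* B))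
    ≡⟨ cong (λ z → ⟦ B ⟧ * ((𝟙 (x ∈? λ') * I′) * z)) (inv-homo-* (πc c ℕ.* P) B) ⟩
  ⟦ B ⟧ * ((𝟙 (x ∈? λ') * I′) * (inv (πc c ℕ.* P) * inv B))
    ≡⟨ solve 5 (λ a n i p v → a :* ((n :* i) :* (p :* v)) := (n :* (i :* p)) :* (a :* v)) refl
         ⟦ B ⟧ (𝟙 (x ∈? λ')) I′ (inv (πc c ℕ.* P)) (inv B) ⟩
  (𝟙 (x ∈? λ') * (I′ * inv (πc c ℕ.* P))) * (⟦ B ⟧ * inv B)
    ≡⟨ trans (cong (𝟙 (x ∈? λ') * (I′ * inv (πc c ℕ.* P)) *_) (⟦⟧*inv B)) (ℚ.*-identityʳ _) ⟩
  𝟙 (x ∈? λ') * refinementTerm (delete x λ') (c ∷ r)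
    ∎
  where
  B = suc b
  P = πblocks r
  I′ = 𝟙 (sortsTo? (c ++ concat r) (delete x λ'))
  π-last : πc (c ∷ʳ x) ℕ.* P ≡ (πc c ℕ.* P) ℕ.* B
  π-last = begin
    πc (c ∷ʳ x) ℕ.* P             ≡⟨ cong (ℕ._* P) (trans (π-snoc 0 c x) (cong (πc c ℕ.*_) |c|+x≡B)) ⟩
    (πc c ℕ.* B) ℕ.* P            ≡⟨ ℕsolve 3 (λ p b q → (p ℕ:* b) ℕ:* q ℕ:= (p ℕ:* q) ℕ:* b) refl (πc c) B P ⟩
    (πc c ℕ.* P) ℕ.* B            ∎

-- Recursion for S in the first part B > 0 of β: the last part x = B - k of the first block
-- is removed, leaving a refinement of (k, β′) of the partition λ∖x.
refinementSum-step : ∀ λ' b bs → Desc λ' →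
  ⟦ suc b ⟧ * refinementSum λ' (suc b ∷ bs)
    ≡ ∑[ k ∈ upTo (suc b) ] (𝟙 ((suc b ∸ k) ∈? λ') * refinementSum (delete (suc b ∸ k) λ') (k ∷ bs))
refinementSum-step λ' b bs λ↘ = begin
  ⟦ B ⟧ * refinementSum λ' (B ∷ bs)
    ≡⟨ cong (⟦ B ⟧ *_) (trans (refinementSum-cons λ' B bs) (∑-compositions-by-last b g)) ⟩
  ⟦ B ⟧ * ∑[ k ∈ upTo B ] ∑[ c ∈ compositions k ] g (c ∷ʳ (B ∸ k))
    ≡⟨ ∑-*ˡ (upTo B) ⟦ B ⟧ _ ⟩
  ∑[ k ∈ upTo B ] (⟦ B ⟧ * ∑[ c ∈ compositions k ] g (c ∷ʳ (B ∸ k)))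
    ≡⟨ ∑-upTo-cong B per-k ⟩
  ∑[ k ∈ upTo B ] (𝟙 ((B ∸ k) ∈? λ') * refinementSum (delete (B ∸ k) λ') (k ∷ bs))
    ∎
  where
  B = suc b
  g : List ℕ → ℚ
  g c = ∑[ r ∈ refinements bs ] refinementTerm λ' (c ∷ r)
  per-k : ∀ k → k < B → ⟦ B ⟧ * ∑[ c ∈ compositions k ] g (c ∷ʳ (B ∸ k))
                         ≡ 𝟙 ((B ∸ k) ∈? λ') * refinementSum (delete (B ∸ k) λ') (k ∷ bs)
  per-k k k<B = begin
    ⟦ B ⟧ * ∑[ c ∈ compositions k ] g (c ∷ʳ x)
      ≡⟨ trans (∑-*ˡ (compositions k) ⟦ B ⟧ _) (∑-congᴬ (compositions-sum k) (λ c |c|≡k →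
           trans (∑-*ˡ (refinements bs) ⟦ B ⟧ _) (∑-cong (refinements bs) (λ r →
             remove-last-part b c x r λ↘ (trans (cong (ℕ._+ x) |c|≡k) (ℕ.m+[n∸m]≡n (ℕ.<⇒≤ k<B))))))) ⟩
    ∑[ c ∈ compositions k ] ∑[ r ∈ refinements bs ] (𝟙 (x ∈? λ') * refinementTerm (delete x λ') (c ∷ r))
      ≡⟨ trans (∑-cong (compositions k) (λ c → sym (∑-*ˡ (refinements bs) (𝟙 (x ∈? λ')) _)))
               (sym (∑-*ˡ (compositions k) (𝟙 (x ∈? λ')) _)) ⟩
    𝟙 (x ∈? λ') * ∑[ c ∈ compositions k ] ∑[ r ∈ refinements bs ] refinementTerm (delete x λ') (c ∷ r)
      ≡⟨ cong (𝟙 (x ∈? λ') *_) (sym (refinementSum-cons (delete x λ') k bs)) ⟩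
    𝟙 (x ∈? λ') * refinementSum (delete x λ') (k ∷ bs)
      ∎
    where x = B ∸ k

pickOne-delete : ∀ λ' → Desc λ' → All (λ p → proj₁ p ∈ λ' × proj₂ p ≡ delete (proj₁ p) λ') (pickOne λ')
pickOne-delete []       _  = []
pickOne-delete (l ∷ ls) λ↘ =
  (here refl , sym (delete-head l ls)) ∷ All.map⁺ (All.map under-head (pickOne-delete ls (desc-tail λ↘)))
  where
  under-head : ∀ {p} → proj₁ p ∈ ls × proj₂ p ≡ delete (proj₁ p) ls →
               proj₁ p ∈ l ∷ ls × l ∷ proj₂ p ≡ delete (proj₁ p) (l ∷ ls)
  under-head (x∈ls , r≡) = there x∈ls , trans (cong (l ∷_) r≡) (delete-under-head ls λ↘ x∈ls)

∑-pickOne-fst : ∀ λ' (G : ℕ → ℚ) → ∑[ p ∈ pickOne λ' ] G (proj₁ p) ≡ ∑ λ' G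
∑-pickOne-fst []       G = refl
∑-pickOne-fst (l ∷ ls) G =
  cong (G l +_) (trans (∑-map (Product.map₂ (l ∷_)) (pickOne ls) (G ∘ proj₁)) (∑-pickOne-fst ls G))

R-step : ∀ λ' b bs → Desc λ' →
  ⟦ suc b ⟧ * ⟦ R λ' (suc b ∷ bs) ⟧
    ≡ ∑[ x ∈ λ' ] (𝟙 (x ℕ.≤? suc b) * (⟦ x ⟧ * ⟦ R (delete x λ') ((suc b ∸ x) ∷ bs) ⟧))
R-step λ' b bs λ↘ = begin
  ⟦ suc b ⟧ * ⟦ R λ' (suc b ∷ bs) ⟧
    ≡⟨ cong (⟦ suc b ⟧ *_) (R≡count λ' (suc b ∷ bs)) ⟩
  ⟦ suc b ⟧ * count (suc (length bs)) λ' t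
    ≡⟨ weighted-count (length bs) λ' t ⟩
  ∑ (pickOne λ') (pickTerm (length bs) t)
    ≡⟨ ∑-congᴬ (pickOne-delete λ' λ↘) (λ { (x , r) (_ , refl) → picked x }) ⟩
  ∑[ p ∈ pickOne λ' ] F (proj₁ p)
    ≡⟨ ∑-pickOne-fst λ' F ⟩
  ∑ λ' F
    ∎
  where
  t = lookup (suc b ∷ bs)
  F : ℕ → ℚ
  F x = 𝟙 (x ℕ.≤? suc b) * (⟦ x ⟧ * ⟦ R (delete x λ') ((suc b ∸ x) ∷ bs) ⟧)
  picked : ∀ x → pickTerm (length bs) t (x , delete x λ') ≡ F x
  picked x = trans (ℚ.*-assoc (𝟙 (x ℕ.≤? suc b)) ⟦ x ⟧ _) (cong (λ c → 𝟙 (x ℕ.≤? suc b) * (⟦ x ⟧ * c)) (sym R-rest))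
    where
    R-rest : ⟦ R (delete x λ') ((suc b ∸ x) ∷ bs) ⟧ ≡ count (suc (length bs)) (delete x λ') (reduce t Fin.zero x)
    R-rest = trans (R≡count (delete x λ') ((suc b ∸ x) ∷ bs))
                   (count-cong _ (delete x λ') λ { Fin.zero → refl ; (Fin.suc j) → refl })

𝟙-last-value : ∀ B l (p : Dec (suc B ≡ l)) (q : Dec (l ≤ B)) (r : Dec (l ≤ suc B)) → 𝟙 p + 𝟙 q ≡ 𝟙 r
𝟙-last-value B l (yes B+1≡l) (yes l≤B) _          = contradiction (subst (_≤ B) (sym B+1≡l) l≤B) (ℕ.n≮n B)
𝟙-last-value B l (yes _)     (no _)    (yes _)    = refl
𝟙-last-value B l (yes B+1≡l) (no _)    (no l≰B+1) = contradiction (ℕ.≤-reflexive (sym B+1≡l)) l≰B+1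
𝟙-last-value B l (no _)      (yes _)   (yes _)    = refl
𝟙-last-value B l (no _)      (yes l≤B) (no l≰B+1) = contradiction (ℕ.m≤n⇒m≤1+n l≤B) l≰B+1
𝟙-last-value B l (no B+1≢l)  (no l≰B)  (yes l≤B+1) with ℕ.m≤n⇒m<n∨m≡n l≤B+1
... | inj₁ l<B+1 = contradiction (ℕ.≤-pred l<B+1) l≰B
... | inj₂ l≡B+1 = contradiction (sym l≡B+1) B+1≢l
𝟙-last-value B l (no _)      (no _)    (no _)     = refl

∑-single-value : ∀ B l (G : ℕ → ℚ) → 0 < l →
  ∑[ k ∈ upTo B ] (𝟙 ((B ∸ k) ℕ.≟ l) * G (B ∸ k)) ≡ 𝟙 (l ℕ.≤? B) * G l
∑-single-value zero    (suc l) G _   = sym (ℚ.*-zeroˡ (G (suc l)))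
∑-single-value (suc B) l       G l>0 = begin
  ∑[ k ∈ upTo (suc B) ] (𝟙 ((suc B ∸ k) ℕ.≟ l) * G (suc B ∸ k))
    ≡⟨ ∑-upTo-suc B (λ k → 𝟙 ((suc B ∸ k) ℕ.≟ l) * G (suc B ∸ k)) ⟩
  𝟙 (suc B ℕ.≟ l) * G (suc B) + ∑[ k ∈ upTo B ] (𝟙 ((B ∸ k) ℕ.≟ l) * G (B ∸ k))
    ≡⟨ cong₂ _+_ (𝟙-*-cong (suc B ℕ.≟ l) (cong G)) (∑-single-value B l G l>0) ⟩
  𝟙 (suc B ℕ.≟ l) * G l + 𝟙 (l ℕ.≤? B) * G l
    ≡⟨ sym (ℚ.*-distribʳ-+ (G l) (𝟙 (suc B ℕ.≟ l)) (𝟙 (l ℕ.≤? B))) ⟩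
  (𝟙 (suc B ℕ.≟ l) + 𝟙 (l ℕ.≤? B)) * G l
    ≡⟨ cong (_* G l) (𝟙-last-value B l (suc B ℕ.≟ l) (l ℕ.≤? B) (l ℕ.≤? suc B)) ⟩
  𝟙 (l ℕ.≤? suc B) * G l
    ∎

∑-by-value : ∀ B λ' (G : ℕ → ℚ) → All (0 <_) λ' →
  ∑[ x ∈ λ' ] (𝟙 (x ℕ.≤? B) * G x) ≡ ∑[ k ∈ upTo B ] (⟦ mult (B ∸ k) λ' ⟧ * G (B ∸ k))
∑-by-value B []       G _ = sym (trans (∑-cong (upTo B) (λ k → ℚ.*-zeroˡ (G (B ∸ k)))) (∑-zero (upTo B)))
∑-by-value B (l ∷ ls) G (l>0 ∷ ls>0) = begin
  𝟙 (l ℕ.≤? B) * G l + ∑[ x ∈ ls ] (𝟙 (x ℕ.≤? B) * G x)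
    ≡⟨ cong₂ _+_ (sym (∑-single-value B l G l>0)) (∑-by-value B ls G ls>0) ⟩
  ∑[ k ∈ upTo B ] (𝟙 ((B ∸ k) ℕ.≟ l) * G (B ∸ k)) + ∑[ k ∈ upTo B ] (⟦ mult (B ∸ k) ls ⟧ * G (B ∸ k))
    ≡⟨ sym (∑-+ (upTo B) _ _) ⟩
  ∑[ k ∈ upTo B ] (𝟙 ((B ∸ k) ℕ.≟ l) * G (B ∸ k) + ⟦ mult (B ∸ k) ls ⟧ * G (B ∸ k))
    ≡⟨ ∑-cong (upTo B) (λ k → count-l (B ∸ k)) ⟩
  ∑[ k ∈ upTo B ] (⟦ mult (B ∸ k) (l ∷ ls) ⟧ * G (B ∸ k))
    ∎
  where
  count-l : ∀ x → 𝟙 (x ℕ.≟ l) * G x + ⟦ mult x ls ⟧ * G x ≡ ⟦ mult x (l ∷ ls) ⟧ * G x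
  count-l x = trans (sym (ℚ.*-distribʳ-+ (G x) (𝟙 (x ℕ.≟ l)) ⟦ mult x ls ⟧)) (cong (_* G x) (sym (mult-cons x l ls)))

Bounded : ℕ → List ℕ → Set
Bounded N λ' = All (λ x → 0 < x × x ≤ N) λ'

Core : ℕ → List ℕ → List ℕ → Set
Core N λ' β = ⟦ zBounded N λ' ⟧ * refinementSum λ' β ≡ ⟦ R λ' β ⟧

-- One term of the recursion:  z_λ · [x ∈ λ] · S(λ∖x, β′) = m_x(λ) · x · R(λ∖x, β′),
-- given the core identity for λ∖x (z_λ = x · m_x · z_{λ∖x}).
removal-term : ∀ N λ' x β′ → Bounded N λ' → (x ∈ λ' → Core N (delete x λ') β′) →
  ⟦ zBounded N λ' ⟧ * (𝟙 (x ∈? λ') * refinementSum (delete x λ') β′)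
    ≡ ⟦ mult x λ' ⟧ * (⟦ x ⟧ * ⟦ R (delete x λ') β′ ⟧)
removal-term N λ' x β′ bnd ih = by-membership (x ∈? λ')
  where
  Z = zBounded N λ'
  Z′ = zBounded N (delete x λ')
  S′ = refinementSum (delete x λ') β′
  Rx = ⟦ x ⟧ * ⟦ R (delete x λ') β′ ⟧
  by-membership : (x∈? : Dec (x ∈ λ')) → ⟦ Z ⟧ * (𝟙 x∈? * S′) ≡ ⟦ mult x λ' ⟧ * Rx
  by-membership (no x∉λ) = begin
    ⟦ Z ⟧ * (0ℚ * S′)        ≡⟨ trans (cong (⟦ Z ⟧ *_) (ℚ.*-zeroˡ S′)) (ℚ.*-zeroʳ ⟦ Z ⟧) ⟩
    0ℚ                       ≡⟨ sym (ℚ.*-zeroˡ Rx) ⟩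
    ⟦ 0 ⟧ * Rx               ≡⟨ cong (λ m → ⟦ m ⟧ * Rx) (sym (mult-∉ x∉λ)) ⟩
    ⟦ mult x λ' ⟧ * Rx       ∎
  by-membership (yes x∈λ) = begin
    ⟦ Z ⟧ * (1ℚ * S′)
      ≡⟨ cong₂ (λ z s → ⟦ z ⟧ * s) (zBounded-delete λ' (proj₁ bound) (proj₂ bound) x∈λ) (ℚ.*-identityˡ S′) ⟩
    ⟦ (x ℕ.* mult x λ') ℕ.* Z′ ⟧ * S′
      ≡⟨ cong (_* S′) (trans (⟦⟧-homo-* (x ℕ.* mult x λ') Z′)
                             (cong (_* ⟦ Z′ ⟧) (⟦⟧-homo-* x (mult x λ')))) ⟩
    ((⟦ x ⟧ * ⟦ mult x λ' ⟧) * ⟦ Z′ ⟧) * S′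
      ≡⟨ solve 4 (λ a m z s → ((a :* m) :* z) :* s := m :* (a :* (z :* s)))
                 refl ⟦ x ⟧ ⟦ mult x λ' ⟧ ⟦ Z′ ⟧ S′ ⟩
    ⟦ mult x λ' ⟧ * (⟦ x ⟧ * (⟦ Z′ ⟧ * S′))
      ≡⟨ cong (λ c → ⟦ mult x λ' ⟧ * (⟦ x ⟧ * c)) (ih x∈λ) ⟩
    ⟦ mult x λ' ⟧ * Rx
      ∎
    where bound = All.lookup bnd x∈λ

-- Both sides satisfy the same recursion in the first part B > 0 of β.
core-step : ∀ N λ' b bs → Desc λ' → Bounded N λ' →
  (∀ x → x ∈ λ' → ∀ β′ → Core N (delete x λ') β′) → Core N λ' (suc b ∷ bs)
core-step N λ' b bs λ↘ bnd ih = ⟦⟧-cancelˡ b (begin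
  ⟦ B ⟧ * (⟦ Z ⟧ * refinementSum λ' (B ∷ bs))
    ≡⟨ solve 3 (λ b z s → b :* (z :* s) := z :* (b :* s)) refl ⟦ B ⟧ ⟦ Z ⟧ (refinementSum λ' (B ∷ bs)) ⟩
  ⟦ Z ⟧ * (⟦ B ⟧ * refinementSum λ' (B ∷ bs))
    ≡⟨ cong (⟦ Z ⟧ *_) (refinementSum-step λ' b bs λ↘) ⟩
  ⟦ Z ⟧ * ∑ (upTo B) Removed
    ≡⟨ ∑-*ˡ (upTo B) ⟦ Z ⟧ Removed ⟩
  ∑[ k ∈ upTo B ] (⟦ Z ⟧ * Removed k)
    ≡⟨ ∑-upTo-cong B per-k ⟩
  ∑[ k ∈ upTo B ] (⟦ mult (B ∸ k) λ' ⟧ * G (B ∸ k))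
    ≡⟨ sym (∑-by-value B λ' G (All.map proj₁ bnd)) ⟩
  ∑[ x ∈ λ' ] (𝟙 (x ℕ.≤? B) * G x)
    ≡⟨ sym (R-step λ' b bs λ↘) ⟩
  ⟦ B ⟧ * ⟦ R λ' (B ∷ bs) ⟧
    ∎)
  where
  B = suc b
  Z = zBounded N λ'
  Removed : ℕ → ℚ
  Removed k = 𝟙 ((B ∸ k) ∈? λ') * refinementSum (delete (B ∸ k) λ') (k ∷ bs)
  G : ℕ → ℚ
  G x = ⟦ x ⟧ * ⟦ R (delete x λ') ((B ∸ x) ∷ bs) ⟧
  per-k : ∀ k → k < B → ⟦ Z ⟧ * Removed k ≡ ⟦ mult (B ∸ k) λ' ⟧ * G (B ∸ k)
  per-k k k<B = trans (removal-term N λ' x (k ∷ bs) bnd (λ x∈λ → ih x x∈λ (k ∷ bs)))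
                      (cong (λ j → ⟦ mult x λ' ⟧ * (⟦ x ⟧ * ⟦ R (delete x λ') (j ∷ bs) ⟧)) (sym (ℕ.m∸[m∸n]≡n (ℕ.<⇒≤ k<B))))
    where x = B ∸ k

-- Induction on ℓ(λ) (the counter n) and on β.
core : ∀ n N λ' β → length λ' ≡ n → Desc λ' → Bounded N λ' → Core N λ' β
core n       N []       []           _ _  _   rewrite zBounded-[] N = refl
core n       N (l ∷ ls) []           _ _  _   = ℚ.*-zeroʳ ⟦ zBounded N (l ∷ ls) ⟧
core n       N λ'       (zero ∷ bs)  ℓ≡n λ↘ bnd = begin
  ⟦ zBounded N λ' ⟧ * refinementSum λ' (0 ∷ bs)
    ≡⟨ cong (⟦ zBounded N λ' ⟧ *_) (refinementSum-zero λ' bs) ⟩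
  ⟦ zBounded N λ' ⟧ * refinementSum λ' bs
    ≡⟨ core n N λ' bs ℓ≡n λ↘ bnd ⟩
  ⟦ R λ' bs ⟧
    ≡⟨ R≡count λ' bs ⟩
  count (length bs) λ' (lookup bs)
    ≡⟨ sym (count-drop-empty-block (length bs) λ' (lookup (0 ∷ bs)) (All.map proj₁ bnd) refl) ⟩
  count (suc (length bs)) λ' (lookup (0 ∷ bs))
    ≡⟨ sym (R≡count λ' (0 ∷ bs)) ⟩
  ⟦ R λ' (0 ∷ bs) ⟧
    ∎
core zero    N []       (suc b ∷ bs) _   λ↘ bnd = core-step N [] b bs λ↘ bnd (λ _ ())
core (suc n) N λ'       (suc b ∷ bs) ℓ≡n λ↘ bnd = core-step N λ' b bs λ↘ bnd (λ x x∈λ β′ →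
  core n N (delete x λ') β′ (ℕ.suc-injective (trans (sym (length-delete λ' x∈λ)) ℓ≡n))
       (desc-delete x λ' λ↘) (all-delete x λ' bnd))

-- Every part of λ is at most |λ|, so z_λ may be computed with the bound N = |λ|.
parts≤sum : ∀ λ' → All (_≤ sum λ') λ'
parts≤sum []       = []
parts≤sum (x ∷ xs) =
  ℕ.m≤m+n x (sum xs) ∷ All.map (λ y≤ → ℕ.≤-trans y≤ (ℕ.m≤n+m (sum xs) x)) (parts≤sum xs)

open import Data.Integer using (+_)

proposition3p17 : (n : ℕ) (λ' β : List ℕ) →
    IsPartition n λ' → IsComposition n β →
    ((+ R λ' β) / 1) * ratio (n !) (zee λ') ≡ rhs n λ' β
proposition3p17 n λ' β ((λ>0 , _) , λ↘) _ = begin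
  ⟦ R λ' β ⟧ * ratio (n !) z          ≡⟨ cong (_* ratio (n !) z) (sym core-identity) ⟩
  (⟦ z ⟧ * S) * ratio (n !) z         ≡⟨ cong ((⟦ z ⟧ * S) *_) (ratio≡⟦⟧*inv (n !) z) ⟩
  (⟦ z ⟧ * S) * (⟦ n ! ⟧ * inv z)     ≡⟨ solve 4 (λ a s f v → (a :* s) :* (f :* v) := (f :* s) :* (a :* v))
                                                 refl ⟦ z ⟧ S ⟦ n ! ⟧ (inv z) ⟩
  (⟦ n ! ⟧ * S) * (⟦ z ⟧ * inv z)     ≡⟨ cong ((⟦ n ! ⟧ * S) *_) (⟦⟧*inv z {{zBounded-nonZero (sum λ') λ'}}) ⟩
  (⟦ n ! ⟧ * S) * 1ℚ                  ≡⟨ ℚ.*-identityʳ _ ⟩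
  ⟦ n ! ⟧ * S                         ≡⟨ sym (rhs≡n!*refinementSum n λ' β) ⟩
  rhs n λ' β                          ∎
  where
  z = zee λ'
  S = refinementSum λ' β
  core-identity : ⟦ z ⟧ * S ≡ ⟦ R λ' β ⟧
  core-identity = core (length λ') (sum λ') λ' β refl λ↘ (All.zip (λ>0 , parts≤sum λ'))
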